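{- Let $r\ne0$. Let $T=\left[\frac{1}{\sqrt{1+2rz}},\ \ln\!\left(\frac{1+z(1+2r)}{1+2rz}\right)\right]$ and $P_n(y)=\sum_{k=0}^nT_{n,k}y^k$. Then $(P_n)$ is a family of orthogonal polynomials (its production matrix is tridiagonal) whose moment sequence $(\mu_n)$ has exponential generating function $\sum_n\mu_n\frac{z^n}{n!}=\frac{1}{\sqrt{1+2r(1-e^z)}}=\mathcal{P}\!\left(\frac{1-3x-(r-2)x^2}{(1-x)(1-2x-2rx^2)}\right)$; moreover $T^{ -1}=\left[\frac{1}{\sqrt{1+2r(1-e^z)}},\ \frac{e^z-1}{1+2r(1-e^z)}\right]$ and the $\mu_n$ are the entries of its initial column.
   Context: An exponential Riordan array $[a(z),b(z)]$ ($a(0)\ne0$, $b(0)=0$, $b'(0)\ne0$) is the lower-triangular matrix with $T_{n,k}=\frac{n!}{k!}[z^n]a(z)b(z)^k$. For monic polynomials $P_n$ with coefficient array $T$, the moment sequence is $\mu_n=L(y^n)$ for the linear functional $L$ with $L(1)=1$ and $L(P_mP_n)=0$ for $m\ne n$. The production matrix of an invertible lower-triangular $M$ is $M^{ -1}\overline M$, $\overline M$ being $M$ with first row deleted. The pipeline $\mathcal{P}$: for $g=\sum g_nx^n$ with $g_0=1$, $g_1\ne1$, set $\tilde g(t)=\sum g_nt^n/n!$, $\varphi(z)=\int_0^z(1-\tilde g'/\tilde g)\,dt$, $\psi$ the compositional inverse of $\varphi$, $\mathcal{P}(g)=\psi'$. Square roots are binomial-series power series with constant term $1$.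
   Formalization: The parameter r ranges over the nonzero rationals. -}

module Defs where

open import Data.Nat using (ℕ; zero; suc)
import Data.Nat as N
open import Data.Integer using (+_)
open import Data.Rational using (ℚ; 0ℚ; 1ℚ; _+_; _*_; -_; _-_; _/_)
open import Data.Product using (Σ; _×_)
open import Relation.Binary.PropositionalEquality using (_≡_; _≢_; _≗_)

sumTo : ℕ → (ℕ → ℚ) → ℚ
sumTo zero    f = 0ℚ
sumTo (suc n) f = sumTo n f + f n

fromℕ : ℕ → ℚ
fromℕ n = + n / 1

invFact : ℕ → ℚ
invFact zero    = 1ℚ
invFact (suc n) = invFact n * (+ 1 / suc n)

fact : ℕ → ℚ
fact zero    = 1ℚ
fact (suc n) = fact n * fromℕ (suc n)

sgn : ℕ → ℚ
sgn zero    = 1ℚ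
sgn (suc n) = - sgn n

gbin : ℚ → ℕ → ℚ
gbin α zero    = 1ℚ
gbin α (suc n) = gbin α n * (α - fromℕ n) * (+ 1 / suc n)

-- Formal power series over ℚ, as coefficient sequences:  f n = [z^n] f

FPS : Set
FPS = ℕ → ℚ

one : FPS
one zero    = 1ℚ
one (suc n) = 0ℚ

X : FPS
X 1 = 1ℚ
X _ = 0ℚ

_⊕_ : FPS → FPS → FPS
(f ⊕ g) n = f n + g n

_⊖_ : FPS → FPS → FPS
(f ⊖ g) n = f n - g n

scale : ℚ → FPS → FPS
scale c f n = c * f n

_⊛_ : FPS → FPS → FPS
(f ⊛ g) n = sumTo (suc n) (λ i → f i * g (n N.∸ i))

pow : FPS → ℕ → FPS
pow f zero    = one
pow f (suc k) = f ⊛ pow f k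

-- composition g ∘ f, meaningful when f 0 = 0 (then exact)
compose : FPS → FPS → FPS
compose g f n = sumTo (suc n) (λ k → g k * pow f k n)

D : FPS → FPS
D f n = fromℕ (suc n) * f (suc n)

Integ : FPS → FPS
Integ f zero    = 0ℚ
Integ f (suc n) = f n * (+ 1 / suc n)

expS : FPS
expS = invFact

logS : FPS               -- ln(1+z)
logS zero    = 0ℚ
logS (suc n) = sgn n * (+ 1 / suc n)

geomS : FPS              -- 1/(1+z)
geomS = sgn

binS : ℚ → FPS           -- (1+z)^α, binomial series
binS = gbin

half : ℚ
half = + 1 / 2

-- For F with F 0 = 1 (the only case used):
recip1 : FPS → FPS
recip1 F = compose geomS (F ⊖ one)

sqrt1 : FPS → FPS
sqrt1 F = compose (binS half) (F ⊖ one)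

-- For F with F 0 = 1:  ln F
log1 : FPS → FPS
log1 F = compose logS (F ⊖ one)

Mat : Set
Mat = ℕ → ℕ → ℚ

ERA : FPS → FPS → Mat
ERA a b n k = fact n * invFact k * (a ⊛ pow b k) n

δ : Mat
δ zero    zero    = 1ℚ
δ zero    (suc k) = 0ℚ
δ (suc n) zero    = 0ℚ
δ (suc n) (suc k) = δ n k

-- product A·B for A lower triangular (A n j = 0 for j > n), so the
-- sum over j ≤ n is the full matrix product
lmul : Mat → Mat → Mat
lmul A B n k = sumTo (suc n) (λ j → A n j * B j k)

dropRow : Mat → Mat
dropRow M n k = M (suc n) k

-- P is the production matrix of the invertible lower-triangular M,
-- i.e. P = M⁻¹ M̄, equivalently M P = M̄
IsProductionMatrix : Mat → Mat → Set
IsProductionMatrix M P = ∀ n k → lmul M P n k ≡ dropRow M n k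

Tridiagonal : Mat → Set
Tridiagonal P = ∀ n k → (suc (suc n) N.≤ k → P n k ≡ 0ℚ) × (suc (suc k) N.≤ n → P n k ≡ 0ℚ)

-- coefficient sequence of P_n(y) = Σ_k T n k y^k
row : Mat → ℕ → FPS
row T n k = T n k

-- L(p) for a polynomial p of degree ≤ d, where L(y^ℓ) = μ ℓ
Lfun : (ℕ → ℚ) → ℕ → FPS → ℚ
Lfun μ d p = sumTo (suc d) (λ ℓ → p ℓ * μ ℓ)

-- μ is the moment sequence of the family with coefficient array T:
-- L(1) = 1 and L(P_m P_n) = 0 for m ≠ n
IsMomentSeq : Mat → (ℕ → ℚ) → Set
IsMomentSeq T μ = (μ 0 ≡ 1ℚ) × (∀ m n → m ≢ n → Lfun μ (m N.+ n) (row T m ⊛ row T n) ≡ 0ℚ)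

tildeS : FPS → FPS
tildeS g n = g n * invFact n

phiP : FPS → FPS
phiP g = Integ (one ⊖ (D (tildeS g) ⊛ recip1 (tildeS g)))

IsCompInverse : FPS → FPS → Set
IsCompInverse φ ψ = (ψ 0 ≡ 0ℚ) × (compose φ ψ ≗ X) × (compose ψ φ ≗ X)

-- 𝒫(g) = h  (for g with g 0 = 1, g 1 ≠ 1): the compositional inverse ψ of φ
-- exists, and ψ' = h for it
PipelineEq : FPS → FPS → Set
PipelineEq g h = Σ FPS (IsCompInverse (phiP g)) × (∀ ψ → IsCompInverse (phiP g) ψ → D ψ ≗ h)

poly1 : ℚ → FPS
poly1 c zero = 1ℚ
poly1 c 1    = c
poly1 c _    = 0ℚ

poly2 : ℚ → ℚ → FPS
poly2 c d zero = 1ℚ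
poly2 c d 1    = c
poly2 c d 2    = d
poly2 c d _    = 0ℚ

two : ℚ
two = + 2 / 1

aT : ℚ → FPS
aT r = recip1 (sqrt1 (poly1 (two * r)))

bT : ℚ → FPS
bT r = log1 (poly1 (1ℚ + two * r) ⊛ recip1 (poly1 (two * r)))

Q : ℚ → FPS
Q r = one ⊕ scale (two * r) (one ⊖ expS)

Fmom : ℚ → FPS
Fmom r = recip1 (sqrt1 (Q r))

bU : ℚ → FPS
bU r = (expS ⊖ one) ⊛ recip1 (Q r)

gP : ℚ → FPS
gP r = poly2 (- fromℕ 3) (- (r - two)) ⊛ recip1 (poly1 (- 1ℚ) ⊛ poly2 (- two) (- (two * r)))

module Submission where

-- Everything is done in the ring of formal power series ℚ[[z]] (coefficient
-- sequences).  Then two general facts about exponential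
-- Riordan arrays: the fundamental theorem [a,b]·[A,B] = [a·(A∘b), B∘b] (giving
-- inverses), and the computation of a tridiagonal production matrix from
-- Riccati-type equations a' = a(c₀+c₁b), b' = 1+r₁b+r₂b²; and a Favard-type
-- theorem: if U has a tridiagonal production matrix with unit superdiagonal,
-- the initial column of U is the unique moment sequence of U⁻¹.

open import Defs
open import Data.Nat as N using (ℕ; zero; suc; z≤n; s≤s; _∸_)
import Data.Nat.Properties as NP
open import Data.Integer using () renaming (+_ to ℤ+_)
import Data.Integer as ℤ
import Data.Integer.Properties as ZP
open import Data.Rational using (ℚ; 0ℚ; 1ℚ; _+_; _*_; -_; _-_; _/_)
import Data.Rational.Base as QB
import Data.Rational.Properties as QP
import Data.Rational.Unnormalised as QU
import Data.Rational.Unnormalised.Properties as QUP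
open import Data.Rational.Solver using (module +-*-Solver)
import Data.Nat.GCD as NGCD
import Data.Nat.Coprimality as Cop
open import Data.Product using (Σ; _×_; _,_; proj₁; proj₂)
open import Data.Empty using (⊥-elim)
open import Data.Maybe using (Maybe; just; nothing)
open import Relation.Binary.PropositionalEquality
open import Relation.Nullary using (yes; no)
open import Algebra.Bundles using (CommutativeRing)
open import Level using (0ℓ)
open import Algebra.Bundles.Raw using (RawRing)
import Algebra.Solver.Ring.AlmostCommutativeRing as ACR
import Algebra.Solver.Ring
import Relation.Binary.Reasoning.Setoid as SetoidReasoning

open ≡-Reasoning

module QS = +-*-Solver

sum-cong-< : ∀ n {f g : ℕ → ℚ} → (∀ i → i N.< n → f i ≡ g i) → sumTo n f ≡ sumTo n g
sum-cong-< zero h = refl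
sum-cong-< (suc n) h = cong₂ _+_ (sum-cong-< n (λ i p → h i (NP.m<n⇒m<1+n p))) (h n NP.≤-refl)

sum-cong : ∀ n {f g : ℕ → ℚ} → (∀ i → f i ≡ g i) → sumTo n f ≡ sumTo n g
sum-cong n h = sum-cong-< n (λ i _ → h i)

sum-+ : ∀ n (f g : ℕ → ℚ) → sumTo n (λ i → f i + g i) ≡ sumTo n f + sumTo n g
sum-+ zero f g = refl
sum-+ (suc n) f g = trans (cong (_+ (f n + g n)) (sum-+ n f g))
  (QS.solve 4 (λ a b c d → (a QS.:+ b) QS.:+ (c QS.:+ d) QS.:= (a QS.:+ c) QS.:+ (b QS.:+ d)) refl (sumTo n f) (sumTo n g) (f n) (g n))

sum-*ˡ : ∀ n c (f : ℕ → ℚ) → c * sumTo n f ≡ sumTo n (λ i → c * f i)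
sum-*ˡ zero c f = QP.*-zeroʳ c
sum-*ˡ (suc n) c f = trans (QP.*-distribˡ-+ c (sumTo n f) (f n)) (cong (_+ (c * f n)) (sum-*ˡ n c f))

sum-*ʳ : ∀ n c (f : ℕ → ℚ) → sumTo n f * c ≡ sumTo n (λ i → f i * c)
sum-*ʳ n c f = trans (QP.*-comm _ c) (trans (sum-*ˡ n c f) (sum-cong n (λ i → QP.*-comm c (f i))))

sum-neg : ∀ n (f : ℕ → ℚ) → - sumTo n f ≡ sumTo n (λ i → - f i)
sum-neg zero f = refl
sum-neg (suc n) f = trans (QP.neg-distrib-+ (sumTo n f) (f n)) (cong (_+ (- f n)) (sum-neg n f))

sum-zero : ∀ n (f : ℕ → ℚ) → (∀ i → i N.< n → f i ≡ 0ℚ) → sumTo n f ≡ 0ℚ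
sum-zero zero f h = refl
sum-zero (suc n) f h = trans (cong₂ _+_ (sum-zero n f (λ i p → h i (NP.m<n⇒m<1+n p))) (h n NP.≤-refl)) refl

sum-first : ∀ n (f : ℕ → ℚ) → sumTo (suc n) f ≡ f 0 + sumTo n (λ i → f (suc i))
sum-first zero f = trans (QP.+-identityˡ (f 0)) (sym (QP.+-identityʳ (f 0)))
sum-first (suc n) f = trans (cong (_+ f (suc n)) (sum-first n f)) (QP.+-assoc (f 0) _ _)

sum-rev : ∀ n (f : ℕ → ℚ) → sumTo (suc n) f ≡ sumTo (suc n) (λ i → f (n ∸ i))
sum-rev zero f = refl
sum-rev (suc n) f = begin
  sumTo (suc n) f + f (suc n)                        ≡⟨ cong (_+ f (suc n)) (sum-rev n f) ⟩
  sumTo (suc n) (λ i → f (n ∸ i)) + f (suc n)        ≡⟨ QP.+-comm (sumTo (suc n) (λ i → f (n ∸ i))) (f (suc n)) ⟩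
  f (suc n) + sumTo (suc n) (λ i → f (n ∸ i))        ≡⟨ sym (sum-first (suc n) (λ i → f (suc n ∸ i))) ⟩
  sumTo (suc (suc n)) (λ i → f (suc n ∸ i))          ∎

sum-pad-by : ∀ m k (f : ℕ → ℚ) → (∀ i → m N.≤ i → f i ≡ 0ℚ) → sumTo (m N.+ k) f ≡ sumTo m f
sum-pad-by m zero f h = cong (λ x → sumTo x f) (NP.+-identityʳ m)
sum-pad-by m (suc k) f h = begin
  sumTo (m N.+ suc k) f ≡⟨ cong (λ x → sumTo x f) (NP.+-suc m k) ⟩
  sumTo (m N.+ k) f + f (m N.+ k) ≡⟨ cong₂ _+_ (sum-pad-by m k f h) (h (m N.+ k) (NP.m≤m+n m k)) ⟩
  sumTo m f + 0ℚ ≡⟨ QP.+-identityʳ _ ⟩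
  sumTo m f ∎

sum-pad : ∀ m n (f : ℕ → ℚ) → m N.≤ n → (∀ i → m N.≤ i → f i ≡ 0ℚ) → sumTo n f ≡ sumTo m f
sum-pad m n f le h = trans (cong (λ x → sumTo x f) (sym (NP.m+[n∸m]≡n le))) (sum-pad-by m (n ∸ m) f h)

sum-swap : ∀ n m (F : ℕ → ℕ → ℚ) → sumTo n (λ i → sumTo m (λ j → F i j)) ≡ sumTo m (λ j → sumTo n (λ i → F i j))
sum-swap zero m F = sym (sum-zero m (λ _ → 0ℚ) (λ _ _ → refl))
sum-swap (suc n) m F = begin
  sumTo n (λ i → sumTo m (F i)) + sumTo m (F n) ≡⟨ cong (_+ sumTo m (F n)) (sum-swap n m F) ⟩
  sumTo m (λ j → sumTo n (λ i → F i j)) + sumTo m (F n) ≡⟨ sym (sum-+ m _ _) ⟩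
  sumTo m (λ j → sumTo (suc n) (λ i → F i j)) ∎

sum-single : ∀ n m (f : ℕ → ℚ) → m N.< n → (∀ i → i N.< n → i ≢ m → f i ≡ 0ℚ) → sumTo n f ≡ f m
sum-single zero m f () h
sum-single (suc n) m f p h with m N.≟ n
... | yes refl = trans (cong (_+ f m) (sum-zero m f (λ i q → h i (NP.m<n⇒m<1+n q) (λ e → NP.<-irrefl e q)))) (QP.+-identityˡ _)
... | no ne = trans (cong₂ _+_ (sum-single n m f (NP.≤∧≢⇒< (NP.≤-pred p) ne) (λ i q → h i (NP.m<n⇒m<1+n q))) (h n NP.≤-refl (λ e → ne (sym e)))) (QP.+-identityʳ _)

suc∸ : ∀ {i n} → i N.≤ n → suc n ∸ i ≡ suc (n ∸ i)
suc∸ {i} {n} le = NP.+-∸-assoc 1 le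

sum-triangle : ∀ n (F : ℕ → ℕ → ℕ → ℚ) →
  sumTo (suc n) (λ i → sumTo (suc i) (λ a → F a (i ∸ a) (n ∸ i))) ≡
  sumTo (suc n) (λ a → sumTo (suc (n ∸ a)) (λ b → F a b (n ∸ a ∸ b)))
sum-triangle zero F = refl
sum-triangle (suc n) F = begin
  sumTo (suc n) (λ i → sumTo (suc i) (λ a → F a (i ∸ a) (suc n ∸ i))) + sumTo (suc (suc n)) (λ a → F a (suc n ∸ a) (n ∸ n))
    ≡⟨ cong (λ c → sumTo (suc n) (λ i → sumTo (suc i) (λ a → F a (i ∸ a) (suc n ∸ i))) + sumTo (suc (suc n)) (λ a → F a (suc n ∸ a) c)) (NP.n∸n≡0 n) ⟩
  sumTo (suc n) (λ i → sumTo (suc i) (λ a → F a (i ∸ a) (suc n ∸ i))) + E1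
    ≡⟨ cong (_+ E1) (sum-cong-< (suc n) (λ i p → cong (λ c → sumTo (suc i) (λ a → F a (i ∸ a) c)) (suc∸ (NP.≤-pred p)))) ⟩
  sumTo (suc n) (λ i → sumTo (suc i) (λ a → F' a (i ∸ a) (n ∸ i))) + E1
    ≡⟨ cong (_+ E1) (sum-triangle n F') ⟩
  A + E1
    ≡⟨ cong (λ c → A + (sumTo (suc n) (λ a → F a (suc n ∸ a) 0) + F (suc n) c 0)) (NP.n∸n≡0 n) ⟩
  A + (sumTo (suc n) (λ a → F a (suc n ∸ a) 0) + F (suc n) 0 0)
    ≡⟨ cong (λ z → A + (z + F (suc n) 0 0)) (sum-cong-< (suc n) (λ a p → cong (λ b → F a b 0) (suc∸ (NP.≤-pred p)))) ⟩
  A + (B + F (suc n) 0 0)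
    ≡⟨ sym (QP.+-assoc A B _) ⟩
  (A + B) + F (suc n) 0 0
    ≡⟨ cong (_+ F (suc n) 0 0) (sym (sum-+ (suc n) _ _)) ⟩
  sumTo (suc n) (λ a → sumTo (suc (n ∸ a)) (λ b → F a b (suc (n ∸ a ∸ b))) + F a (suc (n ∸ a)) 0) + F (suc n) 0 0
    ≡⟨ cong (_+ F (suc n) 0 0) (sum-cong-< (suc n) (λ a p → inner a (NP.≤-pred p))) ⟩
  sumTo (suc n) (λ a → sumTo (suc (suc n ∸ a)) (λ b → F a b (suc n ∸ a ∸ b))) + F (suc n) 0 0
    ≡⟨ cong (λ z → sumTo (suc n) (λ a → sumTo (suc (suc n ∸ a)) (λ b → F a b (suc n ∸ a ∸ b))) + z) lastT ⟩
  sumTo (suc (suc n)) (λ a → sumTo (suc (suc n ∸ a)) (λ b → F a b (suc n ∸ a ∸ b))) ∎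
  where
  F' : ℕ → ℕ → ℕ → ℚ
  F' a b c = F a b (suc c)
  E1 : ℚ
  E1 = sumTo (suc (suc n)) (λ a → F a (suc n ∸ a) 0)
  A : ℚ
  A = sumTo (suc n) (λ a → sumTo (suc (n ∸ a)) (λ b → F a b (suc (n ∸ a ∸ b))))
  B : ℚ
  B = sumTo (suc n) (λ a → F a (suc (n ∸ a)) 0)
  lastT : F (suc n) 0 0 ≡ sumTo (suc (suc n ∸ suc n)) (λ b → F (suc n) b (suc n ∸ suc n ∸ b))
  lastT rewrite NP.n∸n≡0 n = sym (QP.+-identityˡ _)
  inner : ∀ a → a N.≤ n → sumTo (suc (n ∸ a)) (λ b → F a b (suc (n ∸ a ∸ b))) + F a (suc (n ∸ a)) 0
        ≡ sumTo (suc (suc n ∸ a)) (λ b → F a b (suc n ∸ a ∸ b))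
  inner a le rewrite suc∸ le =
    cong₂ _+_ (sum-cong-< (suc (n ∸ a)) (λ b q → cong (F a b) (sym (suc∸ (NP.≤-pred q)))))
              (cong (F a (suc (n ∸ a))) (sym (NP.n∸n≡0 (n ∸ a))))

zeroS : FPS
zeroS _ = 0ℚ

negS : FPS → FPS
negS f n = - f n

⊛-cong : ∀ {f f' g g'} → f ≗ f' → g ≗ g' → (f ⊛ g) ≗ (f' ⊛ g')
⊛-cong {f} {f'} {g} {g'} p q n = sum-cong (suc n) (λ i → cong₂ _*_ (p i) (q (n ∸ i)))

⊛-comm : ∀ f g → (f ⊛ g) ≗ (g ⊛ f)
⊛-comm f g n = trans (sum-rev n _) (sum-cong-< (suc n) (λ i p → trans (cong (f (n ∸ i) *_) (cong g (NP.m∸[m∸n]≡n (NP.≤-pred p)))) (QP.*-comm (f (n ∸ i)) (g i))))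

⊛-assoc : ∀ f g h → ((f ⊛ g) ⊛ h) ≗ (f ⊛ (g ⊛ h))
⊛-assoc f g h n = begin
  sumTo (suc n) (λ i → sumTo (suc i) (λ a → f a * g (i ∸ a)) * h (n ∸ i))
    ≡⟨ sum-cong (suc n) (λ i → sum-*ʳ (suc i) (h (n ∸ i)) _) ⟩
  sumTo (suc n) (λ i → sumTo (suc i) (λ a → f a * g (i ∸ a) * h (n ∸ i)))
    ≡⟨ sum-triangle n (λ a b c → f a * g b * h c) ⟩
  sumTo (suc n) (λ a → sumTo (suc (n ∸ a)) (λ b → f a * g b * h (n ∸ a ∸ b)))
    ≡⟨ sum-cong (suc n) (λ a → trans (sum-cong (suc (n ∸ a)) (λ b → QP.*-assoc (f a) _ _)) (sym (sum-*ˡ (suc (n ∸ a)) (f a) _))) ⟩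
  sumTo (suc n) (λ a → f a * (g ⊛ h) (n ∸ a)) ∎

⊛-distribˡ : ∀ f g h → (f ⊛ (g ⊕ h)) ≗ ((f ⊛ g) ⊕ (f ⊛ h))
⊛-distribˡ f g h n = trans (sum-cong (suc n) (λ i → QP.*-distribˡ-+ (f i) _ _)) (sum-+ (suc n) _ _)

⊛-identityˡ : ∀ f → (one ⊛ f) ≗ f
⊛-identityˡ f n = trans (sum-first n _) (trans (cong₂ _+_ (QP.*-identityˡ (f n)) (sum-zero n _ (λ i _ → QP.*-zeroˡ (f (n ∸ suc i))))) (QP.+-identityʳ _))

⊛-identityʳ : ∀ f → (f ⊛ one) ≗ f
⊛-identityʳ f n = trans (⊛-comm f one n) (⊛-identityˡ f n)

⊛-distribʳ : ∀ f g h → ((g ⊕ h) ⊛ f) ≗ ((g ⊛ f) ⊕ (h ⊛ f))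
⊛-distribʳ f g h n = trans (⊛-comm (g ⊕ h) f n) (trans (⊛-distribˡ f g h n) (cong₂ _+_ (⊛-comm f g n) (⊛-comm f h n)))

FPS-CR : CommutativeRing _ _
FPS-CR = record
  { Carrier = FPS ; _≈_ = _≗_ ; _+_ = _⊕_ ; _*_ = _⊛_ ; -_ = negS ; 0# = zeroS ; 1# = one
  ; isCommutativeRing = record
    { isRing = record
      { +-isAbelianGroup = record
        { isGroup = record
          { isMonoid = record
            { isSemigroup = record
              { isMagma = record
                { isEquivalence = record { refl = λ _ → refl ; sym = λ p n → sym (p n) ; trans = λ p q n → trans (p n) (q n) }
                ; ∙-cong = λ p q n → cong₂ _+_ (p n) (q n) }
              ; assoc = λ f g h n → QP.+-assoc (f n) (g n) (h n) }
            ; identity = (λ f n → QP.+-identityˡ (f n)) , (λ f n → QP.+-identityʳ (f n)) }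
          ; inverse = (λ f n → QP.+-inverseˡ (f n)) , (λ f n → QP.+-inverseʳ (f n))
          ; ⁻¹-cong = λ p n → cong -_ (p n) }
        ; comm = λ f g n → QP.+-comm (f n) (g n) }
      ; *-cong = ⊛-cong
      ; *-assoc = ⊛-assoc
      ; *-identity = ⊛-identityˡ , ⊛-identityʳ
      ; distrib = ⊛-distribˡ , ⊛-distribʳ }
    ; *-comm = ⊛-comm } }

≗-trans : ∀ {f g h : FPS} → f ≗ g → g ≗ h → f ≗ h
≗-trans p q n = trans (p n) (q n)

≗-sym : ∀ {f g : FPS} → f ≗ g → g ≗ f
≗-sym p n = sym (p n)

module ≗R = SetoidReasoning (CommutativeRing.setoid FPS-CR)

⊛-congˡ : ∀ {f f'} g → f ≗ f' → (f ⊛ g) ≗ (f' ⊛ g)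
⊛-congˡ {f} {f'} g p = ⊛-cong {f} {f'} {g} {g} p (λ _ → refl)

⊛-congʳ : ∀ f {g g'} → g ≗ g' → (f ⊛ g) ≗ (f ⊛ g')
⊛-congʳ f {g} {g'} p = ⊛-cong {f} {f} {g} {g'} (λ _ → refl) p

⊖-zero : ∀ f g → (∀ n → (f ⊖ g) n ≡ 0ℚ) → f ≗ g
⊖-zero f g z n = trans (QS.solve 2 (λ a b → a QS.:= (a QS.:- b) QS.:+ b) refl (f n) (g n)) (trans (cong (_+ g n) (z n)) (QP.+-identityˡ (g n)))

-- Constant series; cst is a ring morphism ℚ → FPS, which lets the ring solver over
-- FPS treat rational constants as coefficients.
cst : ℚ → FPS
cst c zero = c
cst c (suc n) = 0ℚ

cst1 : FPS
cst1 = cst 1ℚ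

cst-cong : ∀ {a b} → a ≡ b → cst a ≗ cst b
cst-cong e n = cong (λ z → cst z n) e

zeroS≡cst0 : zeroS ≗ cst 0ℚ
zeroS≡cst0 zero = refl
zeroS≡cst0 (suc n) = refl

one≡cst1 : one ≗ cst 1ℚ
one≡cst1 zero = refl
one≡cst1 (suc n) = refl

cst-+ : ∀ a b → cst (a + b) ≗ (cst a ⊕ cst b)
cst-+ a b zero = refl
cst-+ a b (suc n) = refl

cst-* : ∀ a b → cst (a * b) ≗ (cst a ⊛ cst b)
cst-* a b zero = sym (QP.+-identityˡ (a * b))
cst-* a b (suc n) = sym (trans (sum-first (suc n) _) (trans (cong₂ _+_ (QP.*-zeroʳ a) (sum-zero (suc n) _ (λ i _ → QP.*-zeroˡ (cst b (n ∸ i))))) refl))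

cst-neg : ∀ a → cst (- a) ≗ negS (cst a)
cst-neg a zero = refl
cst-neg a (suc n) = refl

ℚ-rawRing : RawRing 0ℓ 0ℓ
ℚ-rawRing = CommutativeRing.rawRing QP.+-*-commutativeRing

FPS-ACR : ACR.AlmostCommutativeRing 0ℓ 0ℓ
FPS-ACR = ACR.fromCommutativeRing FPS-CR

cst-morphism : ACR._-Raw-AlmostCommutative⟶_ ℚ-rawRing FPS-ACR
cst-morphism = record
  { ⟦_⟧ = cst ; +-homo = cst-+ ; *-homo = cst-* ; -‿homo = cst-neg
  ; 0-homo = λ { zero → refl ; (suc n) → refl } ; 1-homo = λ { zero → refl ; (suc n) → refl } }

cst-≟ : ∀ a b → Maybe (cst a ≗ cst b)
cst-≟ a b with a QP.≟ b
... | yes e = just (λ n → cong (λ x → cst x n) e)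
... | no _ = nothing

module FS = Algebra.Solver.Ring ℚ-rawRing FPS-ACR cst-morphism cst-≟
open FS using (_:+_; _:*_; _:-_; :-_; _:=_; con) renaming (solve to fsolve)

scale-cst : ∀ c f → scale c f ≗ (cst c ⊛ f)
scale-cst c f n = sym (trans (sum-first n _) (trans (cong (λ z → c * f n + z) (sum-zero n _ (λ i _ → QP.*-zeroˡ (f (n ∸ suc i))))) (QP.+-identityʳ _)))

scale-⊛ : ∀ c f g → (scale c f ⊛ g) ≗ scale c (f ⊛ g)
scale-⊛ c f g n = trans (sum-cong (suc n) (λ i → QP.*-assoc c (f i) (g (n ∸ i)))) (sym (sum-*ˡ (suc n) c _))

Ord≥ : ℕ → FPS → Set
Ord≥ k f = ∀ n → n N.< k → f n ≡ 0ℚ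

ord-⊛ : ∀ a b f g → Ord≥ a f → Ord≥ b g → Ord≥ (a N.+ b) (f ⊛ g)
ord-⊛ a b f g of og n p = sum-zero (suc n) _ h
  where
  h : ∀ i → i N.< suc n → f i * g (n ∸ i) ≡ 0ℚ
  h i q with i N.<? a
  ... | yes ia = trans (cong (_* g (n ∸ i)) (of i ia)) (QP.*-zeroˡ (g (n ∸ i)))
  ... | no ia = trans (cong (f i *_) (og (n ∸ i) lt)) (QP.*-zeroʳ (f i))
    where
    lt : n ∸ i N.< b
    lt = NP.+-cancelˡ-< i (n ∸ i) b (subst (N._< i N.+ b) (sym (NP.m+[n∸m]≡n (NP.≤-pred q)))
           (NP.<-≤-trans p (NP.+-monoˡ-≤ b (NP.≮⇒≥ ia))))

ord-pow : ∀ f → f 0 ≡ 0ℚ → ∀ k → Ord≥ k (pow f k)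
ord-pow f f0 zero n ()
ord-pow f f0 (suc k) = ord-⊛ 1 k f (pow f k) (λ { zero _ → f0 ; (suc n) (s≤s ()) }) (ord-pow f f0 k)

ord-scale : ∀ {k} c f → Ord≥ k f → Ord≥ k (scale c f)
ord-scale c f o n p = trans (cong (c *_) (o n p)) (QP.*-zeroʳ c)

-- Summable families: if u k has order ≥ k, then famSum u = Σ_k u k is a well-defined
-- series, its n-th coefficient being the finite sum over k ≤ n.  Composition
-- g ∘ f is the family sum Σ_k g_k f^k.
famSum : (ℕ → FPS) → FPS
famSum u n = sumTo (suc n) (λ k → u k n)

IncreasingOrder : (ℕ → FPS) → Set
IncreasingOrder u = ∀ k → Ord≥ k (u k)

famSum-bound : ∀ u → IncreasingOrder u → ∀ n M → n N.< M → famSum u n ≡ sumTo M (λ k → u k n)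
famSum-bound u o n M p = sym (sum-pad (suc n) M _ p (λ k q → o k n q))

famSum-cong : ∀ {u v} → (∀ k → u k ≗ v k) → famSum u ≗ famSum v
famSum-cong e n = sum-cong (suc n) (λ k → e k n)

famSum-scale : ∀ c u → scale c (famSum u) ≗ famSum (λ k → scale c (u k))
famSum-scale c u n = sum-*ˡ (suc n) c _

famSum-⊛ʳ : ∀ u h → IncreasingOrder u → (famSum u ⊛ h) ≗ famSum (λ k → u k ⊛ h)
famSum-⊛ʳ u h o n = begin
  sumTo (suc n) (λ i → famSum u i * h (n ∸ i))
    ≡⟨ sum-cong-< (suc n) (λ i p → cong (_* h (n ∸ i)) (famSum-bound u o i (suc n) p)) ⟩
  sumTo (suc n) (λ i → sumTo (suc n) (λ k → u k i) * h (n ∸ i))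
    ≡⟨ sum-cong (suc n) (λ i → sum-*ʳ (suc n) (h (n ∸ i)) _) ⟩
  sumTo (suc n) (λ i → sumTo (suc n) (λ k → u k i * h (n ∸ i)))
    ≡⟨ sum-swap (suc n) (suc n) _ ⟩
  sumTo (suc n) (λ k → (u k ⊛ h) n) ∎

famSum-⊛ˡ : ∀ u h → IncreasingOrder u → (h ⊛ famSum u) ≗ famSum (λ k → h ⊛ u k)
famSum-⊛ˡ u h o n = trans (⊛-comm h (famSum u) n) (trans (famSum-⊛ʳ u h o n) (famSum-cong (λ k → ⊛-comm (u k) h) n))

famSum-double : ∀ (c : ℕ → ℕ → FPS) → (∀ i j → Ord≥ (i N.+ j) (c i j)) →
  famSum (λ i → famSum (λ j → c i j)) ≗ famSum (λ k n → sumTo (suc k) (λ i → c i (k ∸ i) n))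
famSum-double c o n = begin
  sumTo (suc n) (λ i → sumTo (suc n) (λ j → c i j n))
    ≡⟨ sum-cong-< (suc n) (λ i p → sum-pad (suc (n ∸ i)) (suc n) _ (s≤s (NP.m∸n≤m n i))
          (λ j q → o i j n (lt i j q))) ⟩
  sumTo (suc n) (λ a → sumTo (suc (n ∸ a)) (λ b → c a b n))
    ≡⟨ sym (sum-triangle n (λ a b _ → c a b n)) ⟩
  sumTo (suc n) (λ k → sumTo (suc k) (λ i → c i (k ∸ i) n)) ∎
  where
  lt : ∀ i j → suc (n ∸ i) N.≤ j → n N.< i N.+ j
  lt i j q with i N.≤? n
  ... | yes le = subst (N._< i N.+ j) (NP.m+[n∸m]≡n le) (NP.+-monoʳ-< i q)
  ... | no nle = NP.<-≤-trans (NP.≰⇒> nle) (NP.m≤m+n i j)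

famSum-swap : ∀ (c : ℕ → ℕ → FPS) → (∀ k j → j N.< k → ∀ n → c k j n ≡ 0ℚ) →
  famSum (λ k → famSum (λ j → c k j)) ≗ famSum (λ j n → sumTo (suc j) (λ k → c k j n))
famSum-swap c z n = trans (sum-swap (suc n) (suc n) (λ k j → c k j n))
  (sum-cong-< (suc n) (λ j p → sum-pad (suc j) (suc n) _ p (λ k q → z k j q n)))

pow-add : ∀ f i j → pow f (i N.+ j) ≗ (pow f i ⊛ pow f j)
pow-add f zero j n = sym (⊛-identityˡ (pow f j) n)
pow-add f (suc i) j n = trans (⊛-cong {f} {f} (λ _ → refl) (pow-add f i j) n) (sym (⊛-assoc f (pow f i) (pow f j) n))

compose-mult : ∀ g h f → f 0 ≡ 0ℚ → compose (g ⊛ h) f ≗ (compose g f ⊛ compose h f)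
compose-mult g h f f0 n = sym (begin
  (famSum a ⊛ famSum b) n ≡⟨ famSum-⊛ʳ a (famSum b) oa n ⟩
  famSum (λ i → a i ⊛ famSum b) n ≡⟨ famSum-cong (λ i → famSum-⊛ˡ b (a i) ob) n ⟩
  famSum (λ i → famSum (λ j → a i ⊛ b j)) n ≡⟨ famSum-double (λ i j → a i ⊛ b j) (λ i j → ord-⊛ i j _ _ (oa i) (ob j)) n ⟩
  famSum (λ k m → sumTo (suc k) (λ i → (a i ⊛ b (k ∸ i)) m)) n ≡⟨ famSum-cong (λ k m → pt k m) n ⟩
  compose (g ⊛ h) f n ∎)
  where
  a : ℕ → FPS
  a = λ i → scale (g i) (pow f i)
  b : ℕ → FPS
  b = λ j → scale (h j) (pow f j)
  oa : IncreasingOrder a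
  oa i = ord-scale (g i) _ (ord-pow f f0 i)
  ob : IncreasingOrder b
  ob j = ord-scale (h j) _ (ord-pow f f0 j)
  pt : ∀ k m → sumTo (suc k) (λ i → (a i ⊛ b (k ∸ i)) m) ≡ (g ⊛ h) k * pow f k m
  pt k m = begin
    sumTo (suc k) (λ i → (a i ⊛ b (k ∸ i)) m)
      ≡⟨ sum-cong-< (suc k) (λ i p → trans (sum-cong (suc m) (λ t → QS.solve 4 (λ x y u v → (x QS.:* u) QS.:* (y QS.:* v) QS.:= (x QS.:* y) QS.:* (u QS.:* v)) refl (g i) (h (k ∸ i)) (pow f i t) (pow f (k ∸ i) (m ∸ t))))
           (trans (sym (sum-*ˡ (suc m) (g i * h (k ∸ i)) (λ t → pow f i t * pow f (k ∸ i) (m ∸ t)))) (cong ((g i * h (k ∸ i)) *_) (trans (sym (pow-add f i (k ∸ i) m)) (cong (λ e → pow f e m) (NP.m+[n∸m]≡n (NP.≤-pred p))))))) ⟩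
    sumTo (suc k) (λ i → (g i * h (k ∸ i)) * pow f k m)
      ≡⟨ sym (sum-*ʳ (suc k) (pow f k m) _) ⟩
    (g ⊛ h) k * pow f k m ∎

compose-cong : ∀ {g g' f f'} → g ≗ g' → f ≗ f' → compose g f ≗ compose g' f'
compose-cong {g} {g'} {f} {f'} p q n = sum-cong (suc n) (λ k → cong₂ _*_ (p k) (pow-cong k n))
  where
  pow-cong : ∀ k → pow f k ≗ pow f' k
  pow-cong zero m = refl
  pow-cong (suc k) = ⊛-cong q (pow-cong k)

compose-⊕ : ∀ g h f → compose (g ⊕ h) f ≗ (compose g f ⊕ compose h f)
compose-⊕ g h f n = trans (sum-cong (suc n) (λ k → QP.*-distribʳ-+ (pow f k n) (g k) (h k))) (sum-+ (suc n) _ _)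

compose-scale : ∀ c g f → compose (scale c g) f ≗ scale c (compose g f)
compose-scale c g f n = trans (sum-cong (suc n) (λ k → QP.*-assoc c (g k) (pow f k n))) (sym (sum-*ˡ (suc n) c _))

compose-neg : ∀ g f → compose (negS g) f ≗ negS (compose g f)
compose-neg g f n = trans (sum-cong (suc n) (λ k → sym (QP.neg-distribˡ-* (g k) (pow f k n)))) (sym (sum-neg (suc n) _))

compose-⊖ : ∀ g h f → compose (g ⊖ h) f ≗ (compose g f ⊖ compose h f)
compose-⊖ g h f n = trans (compose-⊕ g (negS h) f n) (cong (compose g f n +_) (compose-neg h f n))

compose-cst : ∀ c f → compose (cst c) f ≗ cst c
compose-cst c f zero = trans (QP.+-identityˡ (c * 1ℚ)) (QP.*-identityʳ c)
compose-cst c f (suc n) = trans (sum-first (suc n) _) (trans (cong₂ _+_ (QP.*-zeroʳ c) (sum-zero (suc n) _ (λ i _ → QP.*-zeroˡ (pow f (suc i) (suc n))))) refl)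

compose-one : ∀ f → compose one f ≗ one
compose-one f = ≗-trans (compose-cong {one} {cst 1ℚ} {f} {f} one≡cst1 (λ _ → refl))
                (≗-trans (compose-cst 1ℚ f) (λ { zero → refl ; (suc n) → refl }))

compose-pow : ∀ h f → f 0 ≡ 0ℚ → ∀ k → compose (pow h k) f ≗ pow (compose h f) k
compose-pow h f f0 zero = compose-one f
compose-pow h f f0 (suc k) = ≗-trans (compose-mult h (pow h k) f f0) (⊛-cong {compose h f} {compose h f} (λ _ → refl) (compose-pow h f f0 k))

X⊛-suc : ∀ f m → (X ⊛ f) (suc m) ≡ f m
X⊛-suc f m = trans (sum-single (suc (suc m)) 1 _ (s≤s (s≤s z≤n)) h) (QP.*-identityˡ (f m))
  where
  h : ∀ i → i N.< suc (suc m) → i ≢ 1 → X i * f (suc m ∸ i) ≡ 0ℚ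
  h zero _ _ = QP.*-zeroˡ (f (suc m))
  h (suc zero) _ ne = ⊥-elim (ne refl)
  h (suc (suc i)) _ _ = QP.*-zeroˡ (f (m ∸ suc i))

X⊛-zero : ∀ f → (X ⊛ f) 0 ≡ 0ℚ
X⊛-zero f = trans (QP.+-identityˡ (X 0 * f 0)) (QP.*-zeroˡ (f 0))

powX-diag : ∀ k → pow X k k ≡ 1ℚ
powX-diag zero = refl
powX-diag (suc k) = trans (X⊛-suc (pow X k) k) (powX-diag k)

powX-off : ∀ k n → k ≢ n → pow X k n ≡ 0ℚ
powX-off zero zero ne = ⊥-elim (ne refl)
powX-off zero (suc n) ne = refl
powX-off (suc k) zero ne = X⊛-zero (pow X k)
powX-off (suc k) (suc n) ne = trans (X⊛-suc (pow X k) n) (powX-off k n (λ e → ne (cong suc e)))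

compose-X : ∀ f → f 0 ≡ 0ℚ → compose X f ≗ f
compose-X f f0 zero = trans (QP.+-identityˡ (X 0 * 1ℚ)) (trans (QP.*-zeroˡ 1ℚ) (sym f0))
compose-X f f0 (suc n) = trans (sum-single (suc (suc n)) 1 _ (s≤s (s≤s z≤n)) h) (trans (QP.*-identityˡ ((f ⊛ one) (suc n))) (⊛-identityʳ f (suc n)))
  where
  h : ∀ i → i N.< suc (suc n) → i ≢ 1 → X i * pow f i (suc n) ≡ 0ℚ
  h zero _ _ = QP.*-zeroˡ (pow f 0 (suc n))
  h (suc zero) _ ne = ⊥-elim (ne refl)
  h (suc (suc i)) _ _ = QP.*-zeroˡ (pow f (suc (suc i)) (suc n))

compose-gX : ∀ g → compose g X ≗ g
compose-gX g n = trans (sum-single (suc n) n _ NP.≤-refl (λ i _ ne → trans (cong (g i *_) (powX-off i n ne)) (QP.*-zeroʳ (g i))))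
  (trans (cong (g n *_) (powX-diag n)) (QP.*-identityʳ (g n)))

compose-assoc : ∀ g h f → h 0 ≡ 0ℚ → f 0 ≡ 0ℚ → compose (compose g h) f ≗ compose g (compose h f)
compose-assoc g h f h0 f0 n = sym (begin
  famSum (λ k → scale (g k) (pow (compose h f) k)) n
    ≡⟨ famSum-cong (λ k m → cong (g k *_) (sym (compose-pow h f f0 k m))) n ⟩
  famSum (λ k → scale (g k) (compose (pow h k) f)) n
    ≡⟨ famSum-cong (λ k → famSum-scale (g k) (λ j → scale (pow h k j) (pow f j))) n ⟩
  famSum (λ k → famSum (λ j → scale (g k) (scale (pow h k j) (pow f j)))) n
    ≡⟨ famSum-swap (λ k j → scale (g k) (scale (pow h k j) (pow f j)))
         (λ k j p m → trans (cong (g k *_) (trans (cong (_* pow f j m) (ord-pow h h0 k j p)) (QP.*-zeroˡ (pow f j m)))) (QP.*-zeroʳ (g k))) n ⟩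
  famSum (λ j m → sumTo (suc j) (λ k → g k * (pow h k j * pow f j m))) n
    ≡⟨ famSum-cong (λ j m → trans (sum-cong (suc j) (λ k → sym (QP.*-assoc (g k) (pow h k j) (pow f j m)))) (sym (sum-*ʳ (suc j) (pow f j m) _))) n ⟩
  compose (compose g h) f n ∎)

fromℕ-num : ∀ n → QB.↥ (fromℕ n) ≡ ℤ+ n
fromℕ-num n = trans (sym (ZP.*-identityʳ (QB.↥ (fromℕ n)))) (subst (λ g → QB.↥ (fromℕ n) ℤ.* ℤ+ g ≡ ℤ+ n) (NGCD.gcd-zeroʳ n) (QP.↥-/ (ℤ+ n) 1))

fromℕ-den : ∀ n → QB.↧ (fromℕ n) ≡ ℤ+ 1
fromℕ-den n = trans (sym (ZP.*-identityʳ (QB.↧ (fromℕ n)))) (subst (λ g → QB.↧ (fromℕ n) ℤ.* ℤ+ g ≡ ℤ+ 1) (NGCD.gcd-zeroʳ n) (QP.↧-/ (ℤ+ n) 1))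

mkN : ℕ → ℚ
mkN n = QB.mkℚ (ℤ+ n) 0 (Cop.sym (Cop.1-coprimeTo n))

fromℕ-mk : ∀ n → fromℕ n ≡ mkN n
fromℕ-mk n = QP.≃⇒≡ (QB.*≡* (trans (cong₂ ℤ._*_ (fromℕ-num n) refl) (cong (ℤ+ n ℤ.*_) (sym (fromℕ-den n)))))

fromℕ-suc : ∀ n → fromℕ (suc n) ≡ 1ℚ + fromℕ n
fromℕ-suc n = QP.toℚᵘ-injective (QUP.≃-trans (QUP.≃-reflexive (cong QB.toℚᵘ (fromℕ-mk (suc n))))
   (QUP.≃-trans (QU.*≡* (trans (ZP.*-identityʳ (ℤ+ suc n)) (sym eq))) (QUP.≃-sym (QUP.≃-trans (QP.toℚᵘ-homo-+ 1ℚ (fromℕ n)) (QUP.+-congʳ (QB.toℚᵘ 1ℚ) (QUP.≃-reflexive (cong QB.toℚᵘ (fromℕ-mk n))))))))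
  where
  eq : (ℤ+ 1 ℤ.* ℤ+ 1 ℤ.+ ℤ+ n ℤ.* ℤ+ 1) ℤ.* ℤ+ 1 ≡ ℤ+ suc n
  eq = trans (ZP.*-identityʳ _) (cong (λ z → ℤ+ 1 ℤ.+ z) (ZP.*-identityʳ (ℤ+ n)))

fromℕ-+ : ∀ m n → fromℕ (m N.+ n) ≡ fromℕ m + fromℕ n
fromℕ-+ zero n = sym (QP.+-identityˡ (fromℕ n))
fromℕ-+ (suc m) n = trans (fromℕ-suc (m N.+ n)) (trans (cong (1ℚ +_) (fromℕ-+ m n)) (trans (sym (QP.+-assoc 1ℚ (fromℕ m) (fromℕ n))) (cong (_+ fromℕ n) (sym (fromℕ-suc m)))))

inv-num : ∀ n → QB.↥ (ℤ+ 1 / suc n) ≡ ℤ+ 1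
inv-num n = trans (sym (ZP.*-identityʳ (QB.↥ (ℤ+ 1 / suc n)))) (subst (λ g → QB.↥ (ℤ+ 1 / suc n) ℤ.* ℤ+ g ≡ ℤ+ 1) (NGCD.gcd-zeroˡ (suc n)) (QP.↥-/ (ℤ+ 1) (suc n)))

inv-den : ∀ n → QB.↧ (ℤ+ 1 / suc n) ≡ ℤ+ suc n
inv-den n = trans (sym (ZP.*-identityʳ (QB.↧ (ℤ+ 1 / suc n)))) (subst (λ g → QB.↧ (ℤ+ 1 / suc n) ℤ.* ℤ+ g ≡ ℤ+ suc n) (NGCD.gcd-zeroˡ (suc n)) (QP.↧-/ (ℤ+ 1) (suc n)))

inv-mk : ∀ n → ℤ+ 1 / suc n ≡ QB.mkℚ (ℤ+ 1) n (Cop.1-coprimeTo (suc n))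
inv-mk n = QP.≃⇒≡ (QB.*≡* (trans (cong₂ ℤ._*_ (inv-num n) refl) (cong (ℤ+ 1 ℤ.*_) (sym (inv-den n)))))

fromℕ-inv : ∀ n → fromℕ (suc n) * (ℤ+ 1 / suc n) ≡ 1ℚ
fromℕ-inv n = trans (cong₂ _*_ (fromℕ-mk (suc n)) (inv-mk n)) (QP.*-inverseʳ (mkN (suc n)))

fromℕ-inv-cancel : ∀ n x → fromℕ (suc n) * (x * (ℤ+ 1 / suc n)) ≡ x
fromℕ-inv-cancel n x = trans (QS.solve 3 (λ a x b → a QS.:* (x QS.:* b) QS.:= x QS.:* (a QS.:* b)) refl (fromℕ (suc n)) x (ℤ+ 1 / suc n))
  (trans (cong (x *_) (fromℕ-inv n)) (QP.*-identityʳ x))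

fromℕ-cancel : ∀ n {x y} → fromℕ (suc n) * x ≡ fromℕ (suc n) * y → x ≡ y
fromℕ-cancel n {x} {y} e = begin
  x ≡⟨ sym (trans (cong (_* x) (trans (QP.*-comm (ℤ+ 1 / suc n) (fromℕ (suc n))) (fromℕ-inv n))) (QP.*-identityˡ x)) ⟩
  (ℤ+ 1 / suc n) * fromℕ (suc n) * x ≡⟨ QP.*-assoc (ℤ+ 1 / suc n) (fromℕ (suc n)) x ⟩
  (ℤ+ 1 / suc n) * (fromℕ (suc n) * x) ≡⟨ cong ((ℤ+ 1 / suc n) *_) e ⟩
  (ℤ+ 1 / suc n) * (fromℕ (suc n) * y) ≡⟨ sym (QP.*-assoc (ℤ+ 1 / suc n) (fromℕ (suc n)) y) ⟩
  (ℤ+ 1 / suc n) * fromℕ (suc n) * y ≡⟨ trans (cong (_* y) (trans (QP.*-comm (ℤ+ 1 / suc n) (fromℕ (suc n))) (fromℕ-inv n))) (QP.*-identityˡ y) ⟩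
  y ∎

invFact-fact : ∀ j → invFact j * fact j ≡ 1ℚ
invFact-fact zero = refl
invFact-fact (suc j) = begin
  invFact j * (ℤ+ 1 / suc j) * (fact j * fromℕ (suc j))
    ≡⟨ QS.solve 4 (λ a b c d → a QS.:* b QS.:* (c QS.:* d) QS.:= (a QS.:* c) QS.:* (d QS.:* b)) refl (invFact j) (ℤ+ 1 / suc j) (fact j) (fromℕ (suc j)) ⟩
  (invFact j * fact j) * (fromℕ (suc j) * (ℤ+ 1 / suc j))
    ≡⟨ cong₂ _*_ (invFact-fact j) (fromℕ-inv j) ⟩
  1ℚ ∎

invFact-step : ∀ m → invFact (suc m) * fromℕ (suc m) ≡ invFact m
invFact-step m = trans (QS.solve 3 (λ a b c → (a QS.:* b) QS.:* c QS.:= a QS.:* (c QS.:* b)) refl (invFact m) (ℤ+ 1 / suc m) (fromℕ (suc m)))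
                   (trans (cong (invFact m *_) (fromℕ-inv m)) (QP.*-identityʳ (invFact m)))

D-cong : ∀ {f g} → f ≗ g → D f ≗ D g
D-cong p n = cong (fromℕ (suc n) *_) (p (suc n))

D-⊕ : ∀ f g → D (f ⊕ g) ≗ (D f ⊕ D g)
D-⊕ f g n = QP.*-distribˡ-+ (fromℕ (suc n)) (f (suc n)) (g (suc n))

D-scale : ∀ c f → D (scale c f) ≗ scale c (D f)
D-scale c f n = QS.solve 3 (λ a b x → a QS.:* (b QS.:* x) QS.:= b QS.:* (a QS.:* x)) refl (fromℕ (suc n)) c (f (suc n))

D-neg : ∀ f → D (negS f) ≗ negS (D f)
D-neg f n = sym (QP.neg-distribʳ-* (fromℕ (suc n)) (f (suc n)))

D-⊖ : ∀ f g → D (f ⊖ g) ≗ (D f ⊖ D g)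
D-⊖ f g n = trans (D-⊕ f (negS g) n) (cong (D f n +_) (D-neg g n))

D-cst : ∀ c → D (cst c) ≗ zeroS
D-cst c n = QP.*-zeroʳ (fromℕ (suc n))

D-one : D one ≗ zeroS
D-one n = QP.*-zeroʳ (fromℕ (suc n))

D-⊛ : ∀ f g → D (f ⊛ g) ≗ ((D f ⊛ g) ⊕ (f ⊛ D g))
D-⊛ f g n = begin
  fromℕ (suc n) * sumTo (suc (suc n)) t
    ≡⟨ sum-*ˡ (suc (suc n)) (fromℕ (suc n)) t ⟩
  sumTo (suc (suc n)) (λ i → fromℕ (suc n) * t i)
    ≡⟨ sum-cong-< (suc (suc n)) (λ i p → trans (cong (_* t i) (trans (cong fromℕ (sym (NP.m+[n∸m]≡n (NP.≤-pred p)))) (fromℕ-+ i (suc n ∸ i))))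
           (QS.solve 4 (λ a b x y → (a QS.:+ b) QS.:* (x QS.:* y) QS.:= a QS.:* x QS.:* y QS.:+ x QS.:* (b QS.:* y)) refl (fromℕ i) (fromℕ (suc n ∸ i)) (f i) (g (suc n ∸ i)))) ⟩
  sumTo (suc (suc n)) (λ i → fromℕ i * f i * g (suc n ∸ i) + f i * (fromℕ (suc n ∸ i) * g (suc n ∸ i)))
    ≡⟨ sum-+ (suc (suc n)) _ _ ⟩
  sumTo (suc (suc n)) (λ i → fromℕ i * f i * g (suc n ∸ i)) + sumTo (suc (suc n)) (λ i → f i * (fromℕ (suc n ∸ i) * g (suc n ∸ i)))
    ≡⟨ cong₂ _+_ A B ⟩
  (D f ⊛ g) n + (f ⊛ D g) n ∎
  where
  t : ℕ → ℚ
  t = λ i → f i * g (suc n ∸ i)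
  A : sumTo (suc (suc n)) (λ i → fromℕ i * f i * g (suc n ∸ i)) ≡ (D f ⊛ g) n
  A = trans (sum-first (suc n) _) (trans (cong (_+ sumTo (suc n) (λ i → fromℕ (suc i) * f (suc i) * g (n ∸ i)))
        (trans (cong (_* g (suc n)) (QP.*-zeroˡ (f 0))) (QP.*-zeroˡ (g (suc n))))) (trans (QP.+-identityˡ _) refl))
  B : sumTo (suc (suc n)) (λ i → f i * (fromℕ (suc n ∸ i) * g (suc n ∸ i))) ≡ (f ⊛ D g) n
  B = trans (cong (sumTo (suc n) (λ i → f i * (fromℕ (suc n ∸ i) * g (suc n ∸ i))) +_)
            (trans (cong (λ z → f (suc n) * (fromℕ z * g (suc n ∸ suc n))) (NP.n∸n≡0 n)) (trans (cong (f (suc n) *_) (QP.*-zeroˡ (g (n ∸ n)))) (QP.*-zeroʳ (f (suc n))))))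
      (trans (QP.+-identityʳ _) (sum-cong-< (suc n) (λ i p → cong (λ z → f i * (fromℕ z * g z)) (suc∸ (NP.≤-pred p)))))

D-Integ : ∀ f → D (Integ f) ≗ f
D-Integ f n = fromℕ-inv-cancel n (f n)

D-expS : D expS ≗ expS
D-expS n = fromℕ-inv-cancel n (invFact n)

D-logS : D logS ≗ geomS
D-logS n = fromℕ-inv-cancel n (sgn n)

D-X : D X ≗ one
D-X zero = refl
D-X (suc n) = QP.*-zeroʳ (fromℕ (suc (suc n)))

shiftEGF : FPS → ℕ → FPS
shiftEGF g k n = g (k N.+ n) * invFact n

D-shiftEGF : ∀ g k → D (shiftEGF g k) ≗ shiftEGF g (suc k)
D-shiftEGF g k n = begin
  fromℕ (suc n) * (g (k N.+ suc n) * (invFact n * (ℤ+ 1 / suc n)))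
    ≡⟨ cong (fromℕ (suc n) *_) (sym (QP.*-assoc (g (k N.+ suc n)) (invFact n) (ℤ+ 1 / suc n))) ⟩
  fromℕ (suc n) * (g (k N.+ suc n) * invFact n * (ℤ+ 1 / suc n))
    ≡⟨ fromℕ-inv-cancel n (g (k N.+ suc n) * invFact n) ⟩
  g (k N.+ suc n) * invFact n
    ≡⟨ cong (λ z → g z * invFact n) (NP.+-suc k n) ⟩
  shiftEGF g (suc k) n ∎

D-inj : ∀ {f g} → D f ≗ D g → f 0 ≡ g 0 → f ≗ g
D-inj p e zero = e
D-inj p e (suc n) = fromℕ-cancel n (p n)

⊛-vanish : ∀ h d n → (∀ m → m N.≤ n → d m ≡ 0ℚ) → (h ⊛ d) n ≡ 0ℚ
⊛-vanish h d n z = sum-zero (suc n) _ (λ i p → trans (cong (h i *_) (z (n ∸ i) (NP.m∸n≤m n i))) (QP.*-zeroʳ (h i)))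

-- Uniqueness for linear ODE systems: if the derivatives of d i up to degree n
-- vanish whenever all d j vanish up to degree n, and all constant terms vanish,
-- then every d i is zero (induction on the degree).
ode-system-unique : ∀ (d : ℕ → FPS) → (∀ i → d i 0 ≡ 0ℚ) →
  (∀ i n → (∀ j m → m N.≤ n → d j m ≡ 0ℚ) → D (d i) n ≡ 0ℚ) → ∀ i n → d i n ≡ 0ℚ
ode-system-unique d d0 step i n = all n i n NP.≤-refl
  where
  all : ∀ n j m → m N.≤ n → d j m ≡ 0ℚ
  all zero j .zero z≤n = d0 j
  all (suc n) j m le with m N.≟ suc n
  ... | no ne = all n j m (NP.≤-pred (NP.≤∧≢⇒< le ne))
  ... | yes refl = fromℕ-cancel n (trans (step j n (all n)) (sym (QP.*-zeroʳ (fromℕ (suc n)))))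

ode-unique : ∀ h d → D d ≗ (h ⊛ d) → d 0 ≡ 0ℚ → d ≗ zeroS
ode-unique h d e d0 n = ode-system-unique (λ _ → d) (λ _ → d0) (λ i n z → trans (e n) (⊛-vanish h d n (z 0))) 0 n

D-famSum : ∀ u → D (famSum u) ≗ (D (u 0) ⊕ famSum (λ k → D (u (suc k))))
D-famSum u n = trans (sum-*ˡ (suc (suc n)) (fromℕ (suc n)) _) (sum-first (suc n) _)

D-pow : ∀ f k → D (pow f (suc k)) ≗ scale (fromℕ (suc k)) (pow f k ⊛ D f)
D-pow f zero n = begin
  D (f ⊛ one) n ≡⟨ D-cong (⊛-identityʳ f) n ⟩
  D f n ≡⟨ sym (⊛-identityˡ (D f) n) ⟩
  (one ⊛ D f) n ≡⟨ sym (QP.*-identityˡ _) ⟩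
  1ℚ * (one ⊛ D f) n ∎
D-pow f (suc k) n = begin
  D (f ⊛ P1) n
    ≡⟨ D-⊛ f P1 n ⟩
  ((D f ⊛ P1) ⊕ (f ⊛ D P1)) n
    ≡⟨ cong ((D f ⊛ P1) n +_) (⊛-cong {f} {f} (λ _ → refl) (≗-trans (D-pow f k) (scale-cst (fromℕ (suc k)) (pow f k ⊛ D f))) n) ⟩
  ((D f ⊛ (f ⊛ P)) ⊕ (f ⊛ (cst c ⊛ (P ⊛ D f)))) n
    ≡⟨ fsolve 4 (λ F P d C → d :* (F :* P) :+ F :* (C :* (P :* d)) := (con 1ℚ :+ C) :* ((F :* P) :* d)) (λ _ → refl) f P (D f) (cst c) n ⟩
  ((cst 1ℚ ⊕ cst c) ⊛ ((f ⊛ P) ⊛ D f)) n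
    ≡⟨ ⊛-cong {cst 1ℚ ⊕ cst c} {cst (1ℚ + c)} {(f ⊛ P) ⊛ D f} {P1 ⊛ D f} (λ m → sym (cst-+ 1ℚ c m)) (λ _ → refl) n ⟩
  (cst (1ℚ + c) ⊛ (P1 ⊛ D f)) n
    ≡⟨ sym (scale-cst (1ℚ + c) (P1 ⊛ D f) n) ⟩
  (1ℚ + c) * (P1 ⊛ D f) n
    ≡⟨ cong (_* (P1 ⊛ D f) n) (sym (fromℕ-suc (suc k))) ⟩
  fromℕ (suc (suc k)) * (P1 ⊛ D f) n ∎
  where
  P : FPS
  P = pow f k
  P1 : FPS
  P1 = pow f (suc k)
  c : ℚ
  c = fromℕ (suc k)

chain-rule : ∀ g f → f 0 ≡ 0ℚ → D (compose g f) ≗ (compose (D g) f ⊛ D f)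
chain-rule g f f0 n = begin
  D (famSum a) n ≡⟨ D-famSum a n ⟩
  D (a 0) n + famSum (λ k → D (a (suc k))) n ≡⟨ cong₂ _+_ (trans (D-scale (g 0) one n) (trans (cong (g 0 *_) (D-one n)) (QP.*-zeroʳ (g 0)))) (famSum-cong step n) ⟩
  0ℚ + famSum (λ k → scale (D g k) (pow f k) ⊛ D f) n ≡⟨ QP.+-identityˡ _ ⟩
  famSum (λ k → scale (D g k) (pow f k) ⊛ D f) n ≡⟨ sym (famSum-⊛ʳ (λ k → scale (D g k) (pow f k)) (D f) (λ k → ord-scale (D g k) _ (ord-pow f f0 k)) n) ⟩
  (compose (D g) f ⊛ D f) n ∎
  where
  a : ℕ → FPS
  a = λ k → scale (g k) (pow f k)
  step : ∀ k → D (a (suc k)) ≗ (scale (D g k) (pow f k) ⊛ D f)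
  step k m = begin
    D (a (suc k)) m ≡⟨ D-scale (g (suc k)) (pow f (suc k)) m ⟩
    g (suc k) * D (pow f (suc k)) m ≡⟨ cong (g (suc k) *_) (D-pow f k m) ⟩
    g (suc k) * (fromℕ (suc k) * (pow f k ⊛ D f) m) ≡⟨ QS.solve 3 (λ a b x → a QS.:* (b QS.:* x) QS.:= (b QS.:* a) QS.:* x) refl (g (suc k)) (fromℕ (suc k)) ((pow f k ⊛ D f) m) ⟩
    D g k * (pow f k ⊛ D f) m ≡⟨ sym (scale-⊛ (D g k) (pow f k) (D f) m) ⟩
    (scale (D g k) (pow f k) ⊛ D f) m ∎

famSum-first : ∀ u → IncreasingOrder u → famSum u ≗ (u 0 ⊕ famSum (λ k → u (suc k)))
famSum-first u o n = begin
  sumTo (suc n) (λ k → u k n) ≡⟨ sum-first n _ ⟩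
  u 0 n + sumTo n (λ k → u (suc k) n) ≡⟨ cong (u 0 n +_) (sym (trans (cong (sumTo n (λ k → u (suc k) n) +_) (o (suc n) n NP.≤-refl)) (QP.+-identityʳ _))) ⟩
  u 0 n + sumTo (suc n) (λ k → u (suc k) n) ∎

famSum-neg : ∀ u → famSum (λ k → negS (u k)) ≗ negS (famSum u)
famSum-neg u n = sym (sum-neg (suc n) _)

minus-one-const0 : ∀ F → F 0 ≡ 1ℚ → (F ⊖ one) 0 ≡ 0ℚ
minus-one-const0 F e = trans (cong (_- 1ℚ) e) refl

one+[F-1] : ∀ F → F ≗ (one ⊕ (F ⊖ one))
one+[F-1] F n = QS.solve 2 (λ x o → x QS.:= o QS.:+ (x QS.:- o)) refl (F n) (one n)

-- 1/F is an inverse of F: the family sum telescopes.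
recip1-invˡ : ∀ F → F 0 ≡ 1ℚ → (recip1 F ⊛ F) ≗ one
recip1-invˡ F e = ≗R.begin
  recip1 F ⊛ F ≗R.≈⟨ ⊛-cong {recip1 F} {recip1 F} (λ _ → refl) (one+[F-1] F) ⟩
  famSum u ⊛ (one ⊕ G) ≗R.≈⟨ ⊛-distribˡ (famSum u) one G ⟩
  (famSum u ⊛ one) ⊕ (famSum u ⊛ G) ≗R.≈⟨ (λ n → cong₂ _+_ (⊛-identityʳ (famSum u) n) (famSum-⊛ʳ u G ou n)) ⟩
  famSum u ⊕ famSum (λ k → u k ⊛ G) ≗R.≈⟨ (λ n → cong₂ _+_ (famSum-first u ou n) (trans (famSum-cong step n) (famSum-neg (λ k → u (suc k)) n))) ⟩
  (u 0 ⊕ famSum (λ k → u (suc k))) ⊕ negS (famSum (λ k → u (suc k))) ≗R.≈⟨ (λ n → QS.solve 2 (λ a b → (a QS.:+ b) QS.:+ (QS.:- b) QS.:= a) refl (u 0 n) (famSum (λ k → u (suc k)) n)) ⟩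
  u 0 ≗R.≈⟨ (λ n → QP.*-identityˡ (one n)) ⟩
  one ≗R.∎
  where
  G : FPS
  G = F ⊖ one
  u : ℕ → FPS
  u = λ k → scale (sgn k) (pow G k)
  ou : IncreasingOrder u
  ou k = ord-scale (sgn k) _ (ord-pow G (minus-one-const0 F e) k)
  step : ∀ k → (u k ⊛ G) ≗ negS (u (suc k))
  step k n = trans (scale-⊛ (sgn k) (pow G k) G n) (trans (cong (sgn k *_) (⊛-comm (pow G k) G n)) (QS.solve 2 (λ a x → a QS.:* x QS.:= QS.:- ((QS.:- a) QS.:* x)) refl (sgn k) (pow G (suc k) n)))

recip1-invʳ : ∀ F → F 0 ≡ 1ℚ → (F ⊛ recip1 F) ≗ one
recip1-invʳ F e = ≗-trans (⊛-comm F (recip1 F)) (recip1-invˡ F e)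

inv-unique : ∀ a b c → (a ⊛ b) ≗ one → (a ⊛ c) ≗ one → b ≗ c
inv-unique a b c p q = ≗R.begin
  b ≗R.≈⟨ ≗-sym (⊛-identityˡ b) ⟩
  one ⊛ b ≗R.≈⟨ ⊛-congˡ b (≗-sym q) ⟩
  (a ⊛ c) ⊛ b ≗R.≈⟨ (λ n → fsolve 3 (λ a b c → (a :* c) :* b := (a :* b) :* c) (λ _ → refl) a b c n) ⟩
  (a ⊛ b) ⊛ c ≗R.≈⟨ ⊛-congˡ c p ⟩
  one ⊛ c ≗R.≈⟨ ⊛-identityˡ c ⟩
  c ≗R.∎

compose-inv : ∀ a b f → f 0 ≡ 0ℚ → (a ⊛ b) ≗ one → (compose a f ⊛ compose b f) ≗ one
compose-inv a b f f0 p = ≗-trans (≗-sym (compose-mult a b f f0)) (≗-trans (compose-cong p (λ _ → refl)) (compose-one f))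

D-[F-1] : ∀ F → D (F ⊖ one) ≗ D F
D-[F-1] F n = trans (D-⊖ F one n) (trans (cong (D F n +_) (cong -_ (D-one n))) (QP.+-identityʳ (D F n)))

D-log1 : ∀ F → F 0 ≡ 1ℚ → D (log1 F) ≗ (recip1 F ⊛ D F)
D-log1 F e = ≗-trans (chain-rule logS (F ⊖ one) (minus-one-const0 F e)) (⊛-cong {compose (D logS) (F ⊖ one)} {recip1 F} {D (F ⊖ one)} {D F} (compose-cong D-logS (λ _ → refl)) (D-[F-1] F))

D-exp : ∀ f → f 0 ≡ 0ℚ → D (compose expS f) ≗ (compose expS f ⊛ D f)
D-exp f f0 = ≗-trans (chain-rule expS f f0) (⊛-congˡ (D f) (compose-cong D-expS (λ _ → refl)))

log1-exp≡X : log1 expS ≗ X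
log1-exp≡X = D-inj (≗-trans (D-log1 expS refl) (≗-trans (⊛-congʳ (recip1 expS) D-expS) (≗-trans (recip1-invˡ expS refl) (≗-sym D-X)))) refl

binomial-ode : ∀ α → ((one ⊕ X) ⊛ D (binS α)) ≗ scale α (binS α)
binomial-ode α n = trans (⊛-distribʳ (D (binS α)) one X n) (trans (cong₂ _+_ (⊛-identityˡ (D (binS α)) n) refl) (h n))
  where
  DB : ∀ n → D (binS α) n ≡ gbin α n * (α - fromℕ n)
  DB n = fromℕ-inv-cancel n (gbin α n * (α - fromℕ n))
  h : ∀ n → D (binS α) n + (X ⊛ D (binS α)) n ≡ α * gbin α n
  h zero = trans (cong₂ _+_ (DB 0) (X⊛-zero (D (binS α)))) (QS.solve 1 (λ a → QS.con 1ℚ QS.:* (a QS.:- QS.con 0ℚ) QS.:+ QS.con 0ℚ QS.:= a QS.:* QS.con 1ℚ) refl α)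
  h (suc m) = trans (cong₂ _+_ (DB (suc m)) (X⊛-suc (D (binS α)) m))
    (QS.solve 3 (λ a b c → b QS.:* (a QS.:- c) QS.:+ c QS.:* b QS.:= a QS.:* b) refl α (gbin α (suc m)) (fromℕ (suc m)))

compose-1X : ∀ G → G 0 ≡ 0ℚ → compose (one ⊕ X) G ≗ (one ⊕ G)
compose-1X G g0 n = trans (compose-⊕ one X G n) (cong₂ _+_ (compose-one G n) (compose-X G g0 n))

sqrt1-ode : ∀ F → F 0 ≡ 1ℚ → (F ⊛ D (sqrt1 F)) ≗ ((cst half ⊛ sqrt1 F) ⊛ D F)
sqrt1-ode F e = ≗R.begin
  F ⊛ D s                     ≗R.≈⟨ ⊛-congʳ F Ds ⟩
  F ⊛ (compose (D B) G ⊛ D F) ≗R.≈⟨ ≗-sym (⊛-assoc F (compose (D B) G) (D F)) ⟩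
  (F ⊛ compose (D B) G) ⊛ D F ≗R.≈⟨ ⊛-congˡ (D F) F·B′∘G ⟩
  (cst half ⊛ s) ⊛ D F        ≗R.∎
  where
  G : FPS
  G = F ⊖ one
  B : FPS
  B = binS half
  s : FPS
  s = sqrt1 F
  g0 : G 0 ≡ 0ℚ
  g0 = minus-one-const0 F e
  -- (1 + z) B' = B/2, composed with G = F - 1.
  F·B′∘G : (F ⊛ compose (D B) G) ≗ (cst half ⊛ s)
  F·B′∘G = ≗R.begin
    F ⊛ compose (D B) G                   ≗R.≈⟨ ⊛-congˡ (compose (D B) G) (≗-trans (one+[F-1] F) (≗-sym (compose-1X G g0))) ⟩
    compose (one ⊕ X) G ⊛ compose (D B) G ≗R.≈⟨ ≗-sym (compose-mult (one ⊕ X) (D B) G g0) ⟩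
    compose ((one ⊕ X) ⊛ D B) G           ≗R.≈⟨ compose-cong (binomial-ode half) (λ _ → refl) ⟩
    compose (scale half B) G              ≗R.≈⟨ compose-scale half B G ⟩
    scale half s                          ≗R.≈⟨ scale-cst half s ⟩
    cst half ⊛ s                          ≗R.∎
  Ds : D s ≗ (compose (D B) G ⊛ D F)
  Ds = ≗-trans (chain-rule B G g0) (⊛-congʳ (compose (D B) G) (D-[F-1] F))

-- If F(0) = 1, the only Δ with F Δ' = Δ F' and Δ(0) = 0 is Δ = 0
-- (it solves Δ' = (F'/F) Δ).
log-ode-unique : ∀ F Δ → F 0 ≡ 1ℚ → (F ⊛ D Δ) ≗ (Δ ⊛ D F) → Δ 0 ≡ 0ℚ → Δ ≗ zeroS
log-ode-unique F Δ e FΔ′≡ΔF′ Δ0 = ode-unique (recip1 F ⊛ D F) Δ DΔ Δ0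
  where
  DΔ : D Δ ≗ ((recip1 F ⊛ D F) ⊛ Δ)
  DΔ = ≗R.begin
    D Δ                  ≗R.≈⟨ ≗-sym (⊛-identityˡ (D Δ)) ⟩
    one ⊛ D Δ            ≗R.≈⟨ ⊛-congˡ (D Δ) (≗-sym (recip1-invˡ F e)) ⟩
    (recip1 F ⊛ F) ⊛ D Δ ≗R.≈⟨ ⊛-assoc (recip1 F) F (D Δ) ⟩
    recip1 F ⊛ (F ⊛ D Δ) ≗R.≈⟨ ⊛-congʳ (recip1 F) FΔ′≡ΔF′ ⟩
    recip1 F ⊛ (Δ ⊛ D F) ≗R.≈⟨ (λ n → fsolve 3 (λ r d f → r :* (d :* f) := (r :* f) :* d) (λ _ → refl) (recip1 F) Δ (D F) n) ⟩
    (recip1 F ⊛ D F) ⊛ Δ ≗R.∎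

-- (√F)² = F: Δ = s² - F satisfies F Δ' = Δ F' by sqrt1-ode.
sqrt1-sq : ∀ F → F 0 ≡ 1ℚ → (sqrt1 F ⊛ sqrt1 F) ≗ F
sqrt1-sq F e = ⊖-zero (s ⊛ s) F (log-ode-unique F Δ e FΔ′≡ΔF′ (cong (λ c → 1ℚ - c) e))
  where
  s : FPS
  s = sqrt1 F
  Δ : FPS
  Δ = (s ⊛ s) ⊖ F
  FΔ′≡ΔF′ : (F ⊛ D Δ) ≗ (Δ ⊛ D F)
  FΔ′≡ΔF′ = ≗R.begin
    F ⊛ D Δ
      ≗R.≈⟨ ⊛-congʳ F (λ n → trans (D-⊖ (s ⊛ s) F n) (cong (_- D F n) (D-⊛ s s n))) ⟩
    F ⊛ (((D s ⊛ s) ⊕ (s ⊛ D s)) ⊖ D F)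
      ≗R.≈⟨ (λ n → fsolve 4 (λ F s d DF → F :* ((d :* s :+ s :* d) :- DF) := (con two :* s) :* (F :* d) :- F :* DF) (λ _ → refl) F s (D s) (D F) n) ⟩
    ((cst two ⊛ s) ⊛ (F ⊛ D s)) ⊕ negS (F ⊛ D F)
      ≗R.≈⟨ (λ n → cong₂ _+_ (⊛-congʳ (cst two ⊛ s) (sqrt1-ode F e) n) refl) ⟩
    ((cst two ⊛ s) ⊛ ((cst half ⊛ s) ⊛ D F)) ⊕ negS (F ⊛ D F)
      ≗R.≈⟨ (λ n → fsolve 3 (λ F s DF → (con two :* s) :* ((con half :* s) :* DF) :- F :* DF := (s :* s :- F) :* DF) (λ _ → refl) F s (D F) n) ⟩
    Δ ⊛ D F ≗R.∎

-- A series y with y(0) = 1 and y² = 1 is 1 (since 2 y y' = 0); hence x² y² = 1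
-- forces x y = 1 when x(0) = y(0) = 1.
square-one⇒one : ∀ y → y 0 ≡ 1ℚ → (y ⊛ y) ≗ one → y ≗ one
square-one⇒one y e p = D-inj (≗-trans Dy0 (≗-sym D-one)) e
  where
  Dyy : (cst two ⊛ (y ⊛ D y)) ≗ zeroS
  Dyy = ≗R.begin
    cst two ⊛ (y ⊛ D y) ≗R.≈⟨ (λ n → fsolve 2 (λ y d → con two :* (y :* d) := d :* y :+ y :* d) (λ _ → refl) y (D y) n) ⟩
    (D y ⊛ y) ⊕ (y ⊛ D y) ≗R.≈⟨ ≗-sym (D-⊛ y y) ⟩
    D (y ⊛ y) ≗R.≈⟨ D-cong p ⟩
    D one ≗R.≈⟨ D-one ⟩
    zeroS ≗R.∎
  Dy0 : D y ≗ zeroS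
  Dy0 = ≗R.begin
    D y ≗R.≈⟨ ≗-sym (⊛-identityˡ (D y)) ⟩
    one ⊛ D y ≗R.≈⟨ ⊛-congˡ (D y) (≗-sym (recip1-invˡ y e)) ⟩
    (recip1 y ⊛ y) ⊛ D y ≗R.≈⟨ (λ n → fsolve 3 (λ r y d → (r :* y) :* d := con half :* (r :* (con two :* (y :* d)))) (λ _ → refl) (recip1 y) y (D y) n) ⟩
    cst half ⊛ (recip1 y ⊛ (cst two ⊛ (y ⊛ D y))) ≗R.≈⟨ ⊛-congʳ (cst half) (⊛-congʳ (recip1 y) Dyy) ⟩
    cst half ⊛ (recip1 y ⊛ zeroS) ≗R.≈⟨ ⊛-congʳ (cst half) (⊛-congʳ (recip1 y) {zeroS} {cst 0ℚ} (λ { zero → refl ; (suc n) → refl })) ⟩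
    cst half ⊛ (recip1 y ⊛ cst 0ℚ) ≗R.≈⟨ (λ n → fsolve 2 (λ h r → h :* (r :* con 0ℚ) := con 0ℚ) (λ _ → refl) (cst half) (recip1 y) n) ⟩
    cst 0ℚ ≗R.≈⟨ (λ { zero → refl ; (suc n) → refl }) ⟩
    zeroS ≗R.∎

squares-inverse⇒inverse : ∀ x y → x 0 ≡ 1ℚ → y 0 ≡ 1ℚ → ((x ⊛ x) ⊛ (y ⊛ y)) ≗ one → (x ⊛ y) ≗ one
squares-inverse⇒inverse x y x0 y0 p = square-one⇒one (x ⊛ y) (trans (cong₂ (λ u v → 0ℚ + u * v) x0 y0) refl)
  (≗-trans (λ n → fsolve 2 (λ x y → (x :* y) :* (x :* y) := (x :* x) :* (y :* y)) (λ _ → refl) x y n) p)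

-- Composition on the left by φ with φ'(0) = 1 is injective on series with zero
-- constant term: the coefficient of z^(n+1) in φ ∘ u is u_(n+1) plus terms
-- depending only on u_1, …, u_n.
pow-coeff-low : ∀ u v n → (∀ m → m N.≤ n → u m ≡ v m) → ∀ k m → m N.≤ n → pow u k m ≡ pow v k m
pow-coeff-low u v n e zero m le = refl
pow-coeff-low u v n e (suc k) m le = sum-cong-< (suc m) (λ i p → cong₂ _*_ (e i (NP.≤-trans (NP.≤-pred p) le)) (pow-coeff-low u v n e k (m ∸ i) (NP.≤-trans (NP.m∸n≤m m i) le)))

pow-coeff-top : ∀ u v n → u 0 ≡ 0ℚ → v 0 ≡ 0ℚ → (∀ m → m N.≤ n → u m ≡ v m) → ∀ k → pow u (suc (suc k)) (suc n) ≡ pow v (suc (suc k)) (suc n)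
pow-coeff-top u v n u0 v0 e k = sum-cong-< (suc (suc n)) h
  where
  h : ∀ i → i N.< suc (suc n) → u i * pow u (suc k) (suc n ∸ i) ≡ v i * pow v (suc k) (suc n ∸ i)
  h zero _ = trans (cong (_* pow u (suc k) (suc n)) u0) (trans (QP.*-zeroˡ (pow u (suc k) (suc n))) (sym (trans (cong (_* pow v (suc k) (suc n)) v0) (QP.*-zeroˡ (pow v (suc k) (suc n))))))
  h (suc i) p with i N.≟ n
  ... | yes refl = trans (cong (u (suc i) *_) (trans (cong (pow u (suc k)) (NP.n∸n≡0 i)) (ord-pow u u0 (suc k) 0 (s≤s z≤n))))
                     (trans (QP.*-zeroʳ (u (suc i))) (sym (trans (cong (v (suc i) *_) (trans (cong (pow v (suc k)) (NP.n∸n≡0 i)) (ord-pow v v0 (suc k) 0 (s≤s z≤n)))) (QP.*-zeroʳ (v (suc i))))))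
  ... | no ne = let lt = NP.≤∧≢⇒< (NP.≤-pred (NP.≤-pred p)) ne in
                cong₂ _*_ (e (suc i) lt) (pow-coeff-low u v n e (suc k) (n ∸ i) (NP.m∸n≤m n i))

compose-inj : ∀ φ u v → φ 1 ≡ 1ℚ → u 0 ≡ 0ℚ → v 0 ≡ 0ℚ → compose φ u ≗ compose φ v → u ≗ v
compose-inj φ u v φ1 u0 v0 e n = all n n NP.≤-refl
  where
  all : ∀ n m → m N.≤ n → u m ≡ v m
  all zero .zero z≤n = trans u0 (sym v0)
  all (suc n) m le with m N.≟ suc n
  ... | no ne = all n m (NP.≤-pred (NP.≤∧≢⇒< le ne))
  ... | yes refl = top
    where
    ih : ∀ m → m N.≤ n → u m ≡ v m
    ih = all n
    rest : ∀ (w : FPS) → sumTo (suc (suc n)) (λ k → φ k * pow w k (suc n)) ≡ φ 0 * 0ℚ + (φ 1 * (w ⊛ one) (suc n) + sumTo n (λ k → φ (suc (suc k)) * pow w (suc (suc k)) (suc n)))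
    rest w = trans (sum-first (suc n) _) (cong (φ 0 * 0ℚ +_) (sum-first n _))
    eqr : sumTo n (λ k → φ (suc (suc k)) * pow u (suc (suc k)) (suc n)) ≡ sumTo n (λ k → φ (suc (suc k)) * pow v (suc (suc k)) (suc n))
    eqr = sum-cong n (λ k → cong (φ (suc (suc k)) *_) (pow-coeff-top u v n u0 v0 ih k))
    top : u (suc n) ≡ v (suc n)
    top = begin
      u (suc n) ≡⟨ sym (⊛-identityʳ u (suc n)) ⟩
      (u ⊛ one) (suc n) ≡⟨ sym (trans (cong (_* (u ⊛ one) (suc n)) φ1) (QP.*-identityˡ _)) ⟩
      φ 1 * (u ⊛ one) (suc n) ≡⟨ QS.solve 3 (λ a x s → a QS.:= (x QS.:+ (a QS.:+ s)) QS.:- (x QS.:+ s)) refl (φ 1 * (u ⊛ one) (suc n)) (φ 0 * 0ℚ) (sumTo n (λ k → φ (suc (suc k)) * pow u (suc (suc k)) (suc n))) ⟩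
      (φ 0 * 0ℚ + (φ 1 * (u ⊛ one) (suc n) + sumTo n (λ k → φ (suc (suc k)) * pow u (suc (suc k)) (suc n)))) - (φ 0 * 0ℚ + sumTo n (λ k → φ (suc (suc k)) * pow u (suc (suc k)) (suc n)))
        ≡⟨ cong₂ (λ a b → a - (φ 0 * 0ℚ + b)) (trans (sym (rest u)) (trans (e (suc n)) (rest v))) eqr ⟩
      (φ 0 * 0ℚ + (φ 1 * (v ⊛ one) (suc n) + sumTo n (λ k → φ (suc (suc k)) * pow v (suc (suc k)) (suc n)))) - (φ 0 * 0ℚ + sumTo n (λ k → φ (suc (suc k)) * pow v (suc (suc k)) (suc n)))
        ≡⟨ sym (QS.solve 3 (λ a x s → a QS.:= (x QS.:+ (a QS.:+ s)) QS.:- (x QS.:+ s)) refl (φ 1 * (v ⊛ one) (suc n)) (φ 0 * 0ℚ) (sumTo n (λ k → φ (suc (suc k)) * pow v (suc (suc k)) (suc n)))) ⟩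
      φ 1 * (v ⊛ one) (suc n) ≡⟨ trans (cong (_* (v ⊛ one) (suc n)) φ1) (QP.*-identityˡ _) ⟩
      (v ⊛ one) (suc n) ≡⟨ ⊛-identityʳ v (suc n) ⟩
      v (suc n) ∎

poly1-eq : ∀ c → poly1 c ≗ (cst1 ⊕ (cst c ⊛ X))
poly1-eq c n = sym (trans (cong (cst1 n +_) (sym (scale-cst c X n))) (h n))
  where
  h : ∀ n → cst1 n + c * X n ≡ poly1 c n
  h zero = trans (cong (1ℚ +_) (QP.*-zeroʳ c)) refl
  h (suc zero) = trans (QP.+-identityˡ (c * 1ℚ)) (QP.*-identityʳ c)
  h (suc (suc n)) = trans (QP.+-identityˡ (c * 0ℚ)) (QP.*-zeroʳ c)

poly2-eq : ∀ c d → poly2 c d ≗ ((cst1 ⊕ (cst c ⊛ X)) ⊕ (cst d ⊛ (X ⊛ X)))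
poly2-eq c d n = sym (trans (cong₂ _+_ (cong (cst1 n +_) (sym (scale-cst c X n))) (sym (scale-cst d (X ⊛ X) n))) (h n))
  where
  h : ∀ n → (cst1 n + c * X n) + d * (X ⊛ X) n ≡ poly2 c d n
  h zero = trans (cong₂ _+_ (cong (1ℚ +_) (QP.*-zeroʳ c)) (trans (cong (d *_) (X⊛-zero X)) (QP.*-zeroʳ d))) refl
  h (suc zero) = trans (cong₂ _+_ (trans (QP.+-identityˡ (c * 1ℚ)) (QP.*-identityʳ c)) (trans (cong (d *_) (X⊛-suc X 0)) (QP.*-zeroʳ d))) (QP.+-identityʳ c)
  h (suc (suc zero)) = trans (cong₂ _+_ (trans (QP.+-identityˡ (c * 0ℚ)) (QP.*-zeroʳ c)) (trans (cong (d *_) (X⊛-suc X 1)) (QP.*-identityʳ d))) (QP.+-identityˡ d)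
  h (suc (suc (suc n))) = trans (cong₂ _+_ (trans (QP.+-identityˡ (c * 0ℚ)) (QP.*-zeroʳ c)) (trans (cong (d *_) (X⊛-suc X (suc (suc n)))) (QP.*-zeroʳ d))) refl

compose-poly1 : ∀ c f → f 0 ≡ 0ℚ → compose (poly1 c) f ≗ (cst1 ⊕ (cst c ⊛ f))
compose-poly1 c f f0 = ≗R.begin
  compose (poly1 c) f ≗R.≈⟨ compose-cong (poly1-eq c) (λ _ → refl) ⟩
  compose (cst1 ⊕ (cst c ⊛ X)) f ≗R.≈⟨ compose-⊕ cst1 (cst c ⊛ X) f ⟩
  compose cst1 f ⊕ compose (cst c ⊛ X) f ≗R.≈⟨ (λ n → cong₂ _+_ (compose-cst 1ℚ f n) (compose-mult (cst c) X f f0 n)) ⟩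
  cst1 ⊕ (compose (cst c) f ⊛ compose X f) ≗R.≈⟨ (λ n → cong (cst1 n +_) (⊛-cong (compose-cst c f) (compose-X f f0) n)) ⟩
  cst1 ⊕ (cst c ⊛ f) ≗R.∎

ERA-cong : ∀ {a a' b b'} → a ≗ a' → b ≗ b' → ∀ n k → ERA a b n k ≡ ERA a' b' n k
ERA-cong {a} {a'} {b} {b'} p q n k = cong (fact n * invFact k *_) (⊛-cong p (powc k) n)
  where
  powc : ∀ k → pow b k ≗ pow b' k
  powc zero m = refl
  powc (suc k) = ⊛-cong q (powc k)

ERA-lower : ∀ a b → b 0 ≡ 0ℚ → ∀ n k → n N.< k → ERA a b n k ≡ 0ℚ
ERA-lower a b b0 n k p = trans (cong (fact n * invFact k *_) (ord-⊛ 0 k a (pow b k) (λ _ ()) (ord-pow b b0 k) n p)) (QP.*-zeroʳ (fact n * invFact k))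

ERA-product : ∀ a b A B → b 0 ≡ 0ℚ → B 0 ≡ 0ℚ → ∀ n k →
  lmul (ERA a b) (ERA A B) n k ≡ ERA (a ⊛ compose A b) (compose B b) n k
ERA-product a b A B b0 B0 n k = begin
  sumTo (suc n) (λ j → fact n * invFact j * (a ⊛ pow b j) n * (fact j * invFact k * C j))
    ≡⟨ sum-cong (suc n) (λ j → trans (QS.solve 6 (λ fn ij x fj ik c → fn QS.:* ij QS.:* x QS.:* (fj QS.:* ik QS.:* c) QS.:= (fn QS.:* ik) QS.:* ((ij QS.:* fj) QS.:* (c QS.:* x))) refl (fact n) (invFact j) ((a ⊛ pow b j) n) (fact j) (invFact k) (C j))
          (trans (cong (λ z → (fact n * invFact k) * (z * (C j * (a ⊛ pow b j) n))) (invFact-fact j)) (cong ((fact n * invFact k) *_) (QP.*-identityˡ _)))) ⟩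
  sumTo (suc n) (λ j → (fact n * invFact k) * (C j * (a ⊛ pow b j) n))
    ≡⟨ sym (sum-*ˡ (suc n) (fact n * invFact k) _) ⟩
  (fact n * invFact k) * sumTo (suc n) (λ j → C j * (a ⊛ pow b j) n)
    ≡⟨ cong ((fact n * invFact k) *_) inner ⟩
  fact n * invFact k * ((a ⊛ compose A b) ⊛ pow (compose B b) k) n ∎
  where
  C : FPS
  C = A ⊛ pow B k
  inner : sumTo (suc n) (λ j → C j * (a ⊛ pow b j) n) ≡ ((a ⊛ compose A b) ⊛ pow (compose B b) k) n
  inner = begin
    sumTo (suc n) (λ j → C j * (a ⊛ pow b j) n)
      ≡⟨ sum-cong (suc n) (λ j → trans (cong (C j *_) (⊛-comm a (pow b j) n)) (trans (sym (scale-⊛ (C j) (pow b j) a n)) (⊛-comm (scale (C j) (pow b j)) a n))) ⟩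
    famSum (λ j → a ⊛ scale (C j) (pow b j)) n
      ≡⟨ sym (famSum-⊛ˡ (λ j → scale (C j) (pow b j)) a (λ j → ord-scale (C j) _ (ord-pow b b0 j)) n) ⟩
    (a ⊛ compose C b) n
      ≡⟨ ⊛-congʳ a (compose-mult A (pow B k) b b0) n ⟩
    (a ⊛ (compose A b ⊛ compose (pow B k) b)) n
      ≡⟨ ⊛-congʳ a (⊛-congʳ (compose A b) (compose-pow B b b0 k)) n ⟩
    (a ⊛ (compose A b ⊛ pow (compose B b) k)) n
      ≡⟨ sym (⊛-assoc a (compose A b) (pow (compose B b) k) n) ⟩
    ((a ⊛ compose A b) ⊛ pow (compose B b) k) n ∎

δ-diag : ∀ n → δ n n ≡ 1ℚ
δ-diag zero = refl
δ-diag (suc n) = δ-diag n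

δ-off : ∀ n k → n ≢ k → δ n k ≡ 0ℚ
δ-off zero zero ne = ⊥-elim (ne refl)
δ-off zero (suc k) ne = refl
δ-off (suc n) zero ne = refl
δ-off (suc n) (suc k) ne = δ-off n k (λ e → ne (cong suc e))

ERA-id : ∀ n k → ERA one X n k ≡ δ n k
ERA-id n k with n N.≟ k
... | yes refl = trans (cong (fact n * invFact n *_) (trans (⊛-identityˡ (pow X n) n) (powX-diag n)))
                   (trans (QP.*-identityʳ _) (trans (QP.*-comm (fact n) (invFact n)) (trans (invFact-fact n) (sym (δ-diag n)))))
... | no ne = trans (cong (fact n * invFact k *_) (trans (⊛-identityˡ (pow X k) n) (powX-off k n (λ e → ne (sym e)))))
                   (trans (QP.*-zeroʳ (fact n * invFact k)) (sym (δ-off n k ne)))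

ERA-inverse : ∀ a b A B → b 0 ≡ 0ℚ → B 0 ≡ 0ℚ → (a ⊛ compose A b) ≗ one → compose B b ≗ X →
  ∀ n k → lmul (ERA a b) (ERA A B) n k ≡ δ n k
ERA-inverse a b A B b0 B0 p q n k = trans (ERA-product a b A B b0 B0 n k) (trans (ERA-cong p q n k) (ERA-id n k))

ERA-column : ∀ a b n → ERA a b n 0 * invFact n ≡ a n
ERA-column a b n = trans (cong (_* invFact n) (cong (fact n * invFact 0 *_) (⊛-identityʳ a n)))
  (trans (QS.solve 3 (λ f x i → f QS.:* QS.con 1ℚ QS.:* x QS.:* i QS.:= (i QS.:* f) QS.:* x) refl (fact n) (a n) (invFact n))
    (trans (cong (_* a n) (invFact-fact n)) (QP.*-identityˡ (a n))))

sum-δ : ∀ (A : Mat) n m c → (∀ n m → n N.< m → A n m ≡ 0ℚ) →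
  sumTo (suc n) (λ j → A n j * (δ j m * c)) ≡ A n m * c
sum-δ A n m c low with m N.≤? n
... | yes le = trans (sum-single (suc n) m _ (s≤s le) (λ j _ ne → trans (cong (λ z → A n j * (z * c)) (δ-off j m ne)) (trans (cong (A n j *_) (QP.*-zeroˡ c)) (QP.*-zeroʳ (A n j)))))
                 (trans (cong (λ z → A n m * (z * c)) (δ-diag m)) (cong (A n m *_) (QP.*-identityˡ c)))
... | no nle = trans (sum-zero (suc n) _ (λ j p → trans (cong (λ z → A n j * (z * c)) (δ-off j m (λ e → nle (subst (N._≤ n) e (NP.≤-pred p)))))
                   (trans (cong (A n j *_) (QP.*-zeroˡ c)) (QP.*-zeroʳ (A n j)))))
                 (sym (trans (cong (_* c) (low n m (NP.≰⇒> nle))) (QP.*-zeroˡ c)))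

lmul-pad : ∀ (A B : Mat) → (∀ n m → n N.< m → A n m ≡ 0ℚ) → ∀ m l K → m N.< K →
  lmul A B m l ≡ sumTo K (λ a → A m a * B a l)
lmul-pad A B low m l K p = sym (sum-pad (suc m) K _ p (λ a q → trans (cong (_* B a l) (low m a q)) (QP.*-zeroˡ (B a l))))

-- If
--   a' = a · (c₀ + c₁ b)   and   b' = 1 + r₁ b + r₂ b²,
-- then the production matrix of U = [a, b] is tridiagonal, with 1 on the
-- superdiagonal, c₀ + k r₁ in position (k, k) and (k+1)(c₁ + k r₂) in position
-- (k+1, k).  Indeed a b^k is the e.g.f. of column k of U (up to k!), and
-- differentiating it shifts the rows: this is the three-term recurrence U-rec.
module ERAProduction (a b : FPS) (c₀ c₁ r₁ r₂ : ℚ) (b0 : b 0 ≡ 0ℚ)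
  (Da : D a ≗ (a ⊛ (cst c₀ ⊕ (cst c₁ ⊛ b))))
  (Db : D b ≗ ((cst1 ⊕ (cst r₁ ⊛ b)) ⊕ (cst r₂ ⊛ (b ⊛ b)))) where

  U : Mat
  U = ERA a b

  diag-coeff : ℕ → ℚ
  diag-coeff k = c₀ + fromℕ k * r₁

  sub-coeff : ℕ → ℚ
  sub-coeff k = c₁ + fromℕ k * r₂

  diag-coeff-cst : ∀ k → cst (diag-coeff k) ≗ (cst c₀ ⊕ (cst (fromℕ k) ⊛ cst r₁))
  diag-coeff-cst k = ≗-trans (cst-+ c₀ (fromℕ k * r₁)) (λ n → cong (cst c₀ n +_) (cst-* (fromℕ k) r₁ n))

  sub-coeff-cst : ∀ k → cst (sub-coeff k) ≗ (cst c₁ ⊕ (cst (fromℕ k) ⊛ cst r₂))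
  sub-coeff-cst k = ≗-trans (cst-+ c₁ (fromℕ k * r₂)) (λ n → cong (cst c₁ n +_) (cst-* (fromℕ k) r₂ n))

  D-column : ∀ k → D (a ⊛ pow b k) ≗
    ((cst (fromℕ k) ⊛ (a ⊛ pow b (k ∸ 1))) ⊕ (cst (diag-coeff k) ⊛ (a ⊛ pow b k))) ⊕ (cst (sub-coeff k) ⊛ (a ⊛ pow b (suc k)))
  D-column zero = ≗R.begin
    D (a ⊛ one) ≗R.≈⟨ D-cong (⊛-identityʳ a) ⟩
    D a ≗R.≈⟨ Da ⟩
    a ⊛ (cst c₀ ⊕ (cst c₁ ⊛ b)) ≗R.≈⟨ (λ n → fsolve 6 (λ F c0 c1 b K K2 → F :* (c0 :+ c1 :* b) := (con 0ℚ :* (F :* con 1ℚ) :+ (c0 :+ con 0ℚ :* K) :* (F :* con 1ℚ)) :+ (c1 :+ con 0ℚ :* K2) :* (F :* (b :* con 1ℚ))) (λ _ → refl) a (cst c₀) (cst c₁) b (cst r₁) (cst r₂) n) ⟩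
    ((cst 0ℚ ⊛ (a ⊛ cst1)) ⊕ ((cst c₀ ⊕ (cst 0ℚ ⊛ cst r₁)) ⊛ (a ⊛ cst1))) ⊕ ((cst c₁ ⊕ (cst 0ℚ ⊛ cst r₂)) ⊛ (a ⊛ (b ⊛ cst1)))
      ≗R.≈⟨ (λ n → cong₂ _+_ (cong₂ _+_ (⊛-congʳ (cst 0ℚ) (⊛-congʳ a (≗-sym one≡cst1)) n)
                                        (⊛-cong (≗-sym (diag-coeff-cst 0)) (⊛-congʳ a (≗-sym one≡cst1)) n))
                              (⊛-cong (≗-sym (sub-coeff-cst 0)) (⊛-congʳ a (⊛-congʳ b (≗-sym one≡cst1))) n)) ⟩
    ((cst (fromℕ 0) ⊛ (a ⊛ one)) ⊕ (cst (diag-coeff 0) ⊛ (a ⊛ one))) ⊕ (cst (sub-coeff 0) ⊛ (a ⊛ (b ⊛ one))) ≗R.∎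
  D-column (suc j) = ≗R.begin
    D (a ⊛ (b ⊛ P)) ≗R.≈⟨ D-⊛ a (b ⊛ P) ⟩
    (D a ⊛ (b ⊛ P)) ⊕ (a ⊛ D (b ⊛ P))
      ≗R.≈⟨ (λ n → cong₂ _+_ (⊛-congˡ (b ⊛ P) Da n)
            (⊛-congʳ a (≗-trans (D-pow b j) (≗-trans (scale-cst K (P ⊛ D b)) (⊛-congʳ (cst K) (⊛-congʳ P Db)))) n)) ⟩
    ((a ⊛ (cst c₀ ⊕ (cst c₁ ⊛ b))) ⊛ (b ⊛ P)) ⊕ (a ⊛ (cst K ⊛ (P ⊛ ((cst1 ⊕ (cst r₁ ⊛ b)) ⊕ (cst r₂ ⊛ (b ⊛ b))))))
      ≗R.≈⟨ (λ n → fsolve 8 (λ F c0 c1 b P k r1 r2 →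
              (F :* (c0 :+ c1 :* b)) :* (b :* P) :+ F :* (k :* (P :* ((con 1ℚ :+ r1 :* b) :+ r2 :* (b :* b))))
              := (k :* (F :* P) :+ (c0 :+ k :* r1) :* (F :* (b :* P))) :+ (c1 :+ k :* r2) :* (F :* (b :* (b :* P))))
              (λ _ → refl) a (cst c₀) (cst c₁) b P (cst K) (cst r₁) (cst r₂) n) ⟩
    ((cst K ⊛ (a ⊛ P)) ⊕ ((cst c₀ ⊕ (cst K ⊛ cst r₁)) ⊛ (a ⊛ (b ⊛ P)))) ⊕ ((cst c₁ ⊕ (cst K ⊛ cst r₂)) ⊛ (a ⊛ (b ⊛ (b ⊛ P))))
      ≗R.≈⟨ (λ n → cong₂ _+_ (cong ((cst K ⊛ (a ⊛ P)) n +_) (⊛-congˡ (a ⊛ (b ⊛ P)) (≗-sym (diag-coeff-cst (suc j))) n))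
                              (⊛-congˡ (a ⊛ (b ⊛ (b ⊛ P))) (≗-sym (sub-coeff-cst (suc j))) n)) ⟩
    ((cst K ⊛ (a ⊛ P)) ⊕ (cst (diag-coeff (suc j)) ⊛ (a ⊛ (b ⊛ P)))) ⊕ (cst (sub-coeff (suc j)) ⊛ (a ⊛ (b ⊛ (b ⊛ P)))) ≗R.∎
    where
    P : FPS
    P = pow b j
    K : ℚ
    K = fromℕ (suc j)

  U-prev : ℕ → ℕ → ℚ
  U-prev n zero = 0ℚ
  U-prev n (suc m) = U n m

  U-rec : ∀ n k → U (suc n) k ≡ (U-prev n k + diag-coeff k * U n k) + (fromℕ (suc k) * sub-coeff k) * U n (suc k)
  U-rec n k = begin
    fact n * fromℕ (suc n) * invFact k * (a ⊛ pow b k) (suc n)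
      ≡⟨ QS.solve 4 (λ a b c d → a QS.:* b QS.:* c QS.:* d QS.:= a QS.:* c QS.:* (b QS.:* d)) refl (fact n) (fromℕ (suc n)) (invFact k) ((a ⊛ pow b k) (suc n)) ⟩
    fact n * invFact k * D (a ⊛ pow b k) n
      ≡⟨ cong (fact n * invFact k *_) (trans (D-column k n) (cong₂ _+_ (cong₂ _+_ (sym (scale-cst (fromℕ k) (a ⊛ pow b (k ∸ 1)) n)) (sym (scale-cst (diag-coeff k) (a ⊛ pow b k) n))) (sym (scale-cst (sub-coeff k) (a ⊛ pow b (suc k)) n)))) ⟩
    fact n * invFact k * ((fromℕ k * A1 + diag-coeff k * A2) + sub-coeff k * A3)
      ≡⟨ QS.solve 6 (λ a i f y u z → a QS.:* i QS.:* ((f QS.:+ y QS.:* u) QS.:+ z) QS.:= (a QS.:* i QS.:* f QS.:+ y QS.:* (a QS.:* i QS.:* u)) QS.:+ a QS.:* i QS.:* z) refl (fact n) (invFact k) (fromℕ k * A1) (diag-coeff k) A2 (sub-coeff k * A3) ⟩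
    (fact n * invFact k * (fromℕ k * A1) + diag-coeff k * U n k) + fact n * invFact k * (sub-coeff k * A3)
      ≡⟨ cong₂ _+_ (cong (_+ diag-coeff k * U n k) (t1 k)) t3 ⟩
    (U-prev n k + diag-coeff k * U n k) + (fromℕ (suc k) * sub-coeff k) * U n (suc k) ∎
    where
    A1 : ℚ
    A1 = (a ⊛ pow b (k ∸ 1)) n
    A2 : ℚ
    A2 = (a ⊛ pow b k) n
    A3 : ℚ
    A3 = (a ⊛ pow b (suc k)) n
    t1 : ∀ k → fact n * invFact k * (fromℕ k * (a ⊛ pow b (k ∸ 1)) n) ≡ U-prev n k
    t1 zero = trans (cong (fact n * invFact 0 *_) (QP.*-zeroˡ ((a ⊛ pow b 0) n))) (QP.*-zeroʳ (fact n * invFact 0))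
    t1 (suc m) = trans (QS.solve 4 (λ a i f x → a QS.:* i QS.:* (f QS.:* x) QS.:= a QS.:* (i QS.:* f) QS.:* x) refl (fact n) (invFact (suc m)) (fromℕ (suc m)) ((a ⊛ pow b m) n))
                   (cong (λ z → fact n * z * (a ⊛ pow b m) n) (invFact-step m))
    t3 : fact n * invFact k * (sub-coeff k * A3) ≡ (fromℕ (suc k) * sub-coeff k) * U n (suc k)
    t3 = trans (cong (λ w → fact n * w * (sub-coeff k * A3)) (sym (invFact-step k)))
           (QS.solve 5 (λ a i f z x → a QS.:* (i QS.:* f) QS.:* (z QS.:* x) QS.:= (f QS.:* z) QS.:* (a QS.:* i QS.:* x)) refl (fact n) (invFact (suc k)) (fromℕ (suc k)) (sub-coeff k) A3)

  prodMatrix : Mat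
  prodMatrix j k = (δ (suc j) k * 1ℚ + δ j k * diag-coeff k) + δ j (suc k) * (fromℕ (suc k) * sub-coeff k)

  U-lower : ∀ n m → n N.< m → U n m ≡ 0ℚ
  U-lower = ERA-lower a b b0

  U-prev-sum : ∀ n k → sumTo (suc n) (λ j → U n j * (δ (suc j) k * 1ℚ)) ≡ U-prev n k
  U-prev-sum n zero = sum-zero (suc n) _ (λ j _ → trans (cong (U n j *_) (QP.*-zeroˡ 1ℚ)) (QP.*-zeroʳ (U n j)))
  U-prev-sum n (suc m) = trans (sum-δ U n m 1ℚ U-lower) (QP.*-identityʳ (U n m))

  prodMatrix-production : IsProductionMatrix U prodMatrix
  prodMatrix-production n k = begin
    sumTo (suc n) (λ j → U n j * prodMatrix j k)
      ≡⟨ sum-cong (suc n) (λ j → QS.solve 4 (λ u a b c → u QS.:* ((a QS.:+ b) QS.:+ c) QS.:= (u QS.:* a QS.:+ u QS.:* b) QS.:+ u QS.:* c) refl (U n j) (δ (suc j) k * 1ℚ) (δ j k * diag-coeff k) (δ j (suc k) * (fromℕ (suc k) * sub-coeff k))) ⟩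
    sumTo (suc n) (λ j → (U n j * (δ (suc j) k * 1ℚ) + U n j * (δ j k * diag-coeff k)) + U n j * (δ j (suc k) * (fromℕ (suc k) * sub-coeff k)))
      ≡⟨ trans (sum-+ (suc n) _ _) (cong (_+ sumTo (suc n) (λ j → U n j * (δ j (suc k) * (fromℕ (suc k) * sub-coeff k)))) (sum-+ (suc n) _ _)) ⟩
    (sumTo (suc n) (λ j → U n j * (δ (suc j) k * 1ℚ)) + sumTo (suc n) (λ j → U n j * (δ j k * diag-coeff k))) + sumTo (suc n) (λ j → U n j * (δ j (suc k) * (fromℕ (suc k) * sub-coeff k)))
      ≡⟨ cong₂ _+_ (cong₂ _+_ (U-prev-sum n k) (trans (sum-δ U n k (diag-coeff k) U-lower) (QP.*-comm (U n k) (diag-coeff k)))) (trans (sum-δ U n (suc k) _ U-lower) (QP.*-comm (U n (suc k)) _)) ⟩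
    (U-prev n k + diag-coeff k * U n k) + (fromℕ (suc k) * sub-coeff k) * U n (suc k)
      ≡⟨ sym (U-rec n k) ⟩
    U (suc n) k ∎

  prodMatrix-tridiagonal : Tridiagonal prodMatrix
  prodMatrix-tridiagonal n k = h1 , h2
    where
    z3 : ∀ {a b c : ℚ} (x w : ℚ) → a ≡ 0ℚ → b ≡ 0ℚ → c ≡ 0ℚ → (a * 1ℚ + b * x) + c * w ≡ 0ℚ
    z3 x w refl refl refl = trans (cong₂ _+_ (cong₂ _+_ (QP.*-zeroˡ 1ℚ) (QP.*-zeroˡ x)) (QP.*-zeroˡ w)) refl
    neq : ∀ {a b} → a N.< b → a ≢ b
    neq p e = NP.<-irrefl e p
    neq' : ∀ {a b} → b N.< a → a ≢ b
    neq' p e = NP.<-irrefl (sym e) p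
    h1 : suc (suc n) N.≤ k → prodMatrix n k ≡ 0ℚ
    h1 le = z3 (diag-coeff k) _ (δ-off (suc n) k (neq le)) (δ-off n k (neq (NP.<-trans (NP.n<1+n n) le)))
                          (δ-off n (suc k) (neq (NP.<-trans (NP.<-trans (NP.n<1+n n) le) (NP.n<1+n k))))
    h2 : suc (suc k) N.≤ n → prodMatrix n k ≡ 0ℚ
    h2 le = z3 (diag-coeff k) _ (δ-off (suc n) k (neq' (NP.<-trans (NP.<-trans (NP.n<1+n k) le) (NP.n<1+n n))))
                          (δ-off n k (neq' (NP.<-trans (NP.n<1+n k) le)))
                          (δ-off n (suc k) (neq' le))

  prodMatrix-super : ∀ l → prodMatrix l (suc l) ≡ 1ℚ
  prodMatrix-super l = trans (cong₂ _+_ (cong₂ _+_ (cong (_* 1ℚ) (δ-diag l)) (cong (_* diag-coeff (suc l)) (δ-off l (suc l) (λ e → NP.<-irrefl e (NP.n<1+n l)))))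
                                (cong (_* (fromℕ (suc (suc l)) * sub-coeff (suc l))) (δ-off l (suc (suc l)) (λ e → NP.<-irrefl e (NP.<-trans (NP.n<1+n l) (NP.n<1+n (suc l)))))))
             (QS.solve 2 (λ y w → (QS.con 1ℚ QS.:* QS.con 1ℚ QS.:+ QS.con 0ℚ QS.:* y) QS.:+ QS.con 0ℚ QS.:* w QS.:= QS.con 1ℚ) refl (diag-coeff (suc l)) (fromℕ (suc (suc l)) * sub-coeff (suc l)))

-- The proof is the Hankel factorisation
--   μ (i + j) = Σ_l U i l · U j l · h l,    h l = P 1 0 · P 2 1 ⋯ P l (l-1),
-- obtained from the symmetry P m l · h l = P l m · h m of the rescaled P;
-- then L(P_m P_n) = Σ_l (T U)_m l (T U)_n l h l = δ_{mn} h m.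
module MomentsFromProduction (T U P : Mat)
  (Tlow : ∀ n m → n N.< m → T n m ≡ 0ℚ) (Ulow : ∀ n m → n N.< m → U n m ≡ 0ℚ)
  (U00 : U 0 0 ≡ 1ℚ) (U-production : IsProductionMatrix U P) (P-tridiagonal : Tridiagonal P)
  (P-super : ∀ l → P l (suc l) ≡ 1ℚ)
  (TU≡δ : ∀ n k → lmul T U n k ≡ δ n k) (UT≡δ : ∀ n k → lmul U T n k ≡ δ n k) where

  μ : ℕ → ℚ
  μ n = U n 0

  T00 : T 0 0 ≡ 1ℚ
  T00 = begin
    T 0 0               ≡⟨ sym (QP.*-identityʳ (T 0 0)) ⟩
    T 0 0 * 1ℚ          ≡⟨ cong (T 0 0 *_) (sym U00) ⟩
    T 0 0 * U 0 0       ≡⟨ sym (QP.+-identityˡ _) ⟩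
    lmul T U 0 0        ≡⟨ TU≡δ 0 0 ⟩
    1ℚ                  ∎

  -- h l = P 1 0 · P 2 1 ⋯ P l (l-1), making P l m · h m symmetric.
  norm : ℕ → ℚ
  norm zero = 1ℚ
  norm (suc l) = norm l * P (suc l) l

  P-far : ∀ m l → m ≢ l → m ≢ suc l → l ≢ suc m → P m l ≡ 0ℚ × P l m ≡ 0ℚ
  P-far m l ne1 ne2 ne3 with m N.<? l
  ... | yes lt = let le = NP.≤∧≢⇒< lt (λ e → ne3 (sym e)) in proj₁ (P-tridiagonal m l) le , proj₂ (P-tridiagonal l m) le
  ... | no nlt = let gt = NP.≤∧≢⇒< (NP.≤∧≢⇒< (NP.≮⇒≥ nlt) (λ e → ne1 (sym e))) (λ e → ne2 (sym e)) in proj₂ (P-tridiagonal m l) gt , proj₁ (P-tridiagonal l m) gt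

  P-sym : ∀ m l → P m l * norm l ≡ P l m * norm m
  P-sym m l with m N.≟ l
  ... | yes refl = refl
  ... | no ne1 with m N.≟ suc l
  ...   | yes refl = trans (QP.*-comm (P (suc l) l) (norm l)) (sym (trans (cong (_* norm (suc l)) (P-super l)) (QP.*-identityˡ (norm (suc l)))))
  ...   | no ne2 with l N.≟ suc m
  ...     | yes refl = sym (trans (QP.*-comm (P (suc m) m) (norm m)) (sym (trans (cong (_* norm (suc m)) (P-super m)) (QP.*-identityˡ (norm (suc m))))))
  ...     | no ne3 = trans (cong (_* norm l) (proj₁ (P-far m l ne1 ne2 ne3))) (trans (QP.*-zeroˡ (norm l)) (sym (trans (cong (_* norm m) (proj₂ (P-far m l ne1 ne2 ne3))) (QP.*-zeroˡ (norm m)))))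

  gram : ℕ → ℕ → ℕ → ℚ
  gram K i j = sumTo K (λ l → U i l * U j l * norm l)

  gram-pad : ∀ K i j → suc i N.≤ K → gram K i j ≡ gram (suc i) i j
  gram-pad K i j le = sum-pad (suc i) K _ le (λ l p → trans (cong (λ z → z * U j l * norm l) (Ulow i l p)) (trans (cong (_* norm l) (QP.*-zeroˡ (U j l))) (QP.*-zeroˡ (norm l))))

  hankel : ∀ i j → μ (i N.+ j) ≡ gram (suc i) i j
  hankel zero j = sym (trans (cong (λ z → 0ℚ + z * U j 0 * 1ℚ) U00) (QS.solve 1 (λ x → QS.con 0ℚ QS.:+ QS.con 1ℚ QS.:* x QS.:* QS.con 1ℚ QS.:= x) refl (U j 0)))
  hankel (suc i) j = sym (begin
    sumTo (suc (suc i)) (λ l → U (suc i) l * U j l * norm l)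
      ≡⟨ sum-cong (suc (suc i)) (λ l → trans (cong (λ z → z * U j l * norm l) (sym (U-production i l)))
           (trans (cong (λ z → z * U j l * norm l) (lmul-pad U P Ulow i l (suc i) NP.≤-refl))
           (trans (QS.solve 3 (λ s u h → s QS.:* u QS.:* h QS.:= s QS.:* (h QS.:* u)) refl (sumTo (suc i) (λ m → U i m * P m l)) (U j l) (norm l))
           (sum-*ʳ (suc i) (norm l * U j l) _)))) ⟩
    sumTo (suc (suc i)) (λ l → sumTo (suc i) (λ m → U i m * P m l * (norm l * U j l)))
      ≡⟨ sum-swap (suc (suc i)) (suc i) _ ⟩
    sumTo (suc i) (λ m → sumTo (suc (suc i)) (λ l → U i m * P m l * (norm l * U j l)))
      ≡⟨ sum-cong (suc i) (λ m → sum-cong (suc (suc i)) (λ l →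
           trans (QS.solve 4 (λ u p h v → u QS.:* p QS.:* (h QS.:* v) QS.:= u QS.:* (p QS.:* h) QS.:* v) refl (U i m) (P m l) (norm l) (U j l))
           (trans (cong (λ z → U i m * z * U j l) (P-sym m l))
           (QS.solve 4 (λ u p h v → u QS.:* (p QS.:* h) QS.:* v QS.:= (u QS.:* h) QS.:* (v QS.:* p)) refl (U i m) (P l m) (norm m) (U j l))))) ⟩
    sumTo (suc i) (λ m → sumTo (suc (suc i)) (λ l → (U i m * norm m) * (U j l * P l m)))
      ≡⟨ sum-cong-< (suc i) (λ m p → trans (sym (sum-*ˡ (suc (suc i)) (U i m * norm m) _)) (cong ((U i m * norm m) *_) (inner m (NP.≤-pred p)))) ⟩
    sumTo (suc i) (λ m → (U i m * norm m) * U (suc j) m)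
      ≡⟨ sum-cong (suc i) (λ m → QS.solve 3 (λ u h v → (u QS.:* h) QS.:* v QS.:= u QS.:* v QS.:* h) refl (U i m) (norm m) (U (suc j) m)) ⟩
    gram (suc i) i (suc j)
      ≡⟨ sym (hankel i (suc j)) ⟩
    μ (i N.+ suc j)
      ≡⟨ cong μ (NP.+-suc i j) ⟩
    μ (suc i N.+ j) ∎)
    where
    K : ℕ
    K = suc (suc (i N.+ j))
    inner : ∀ m → m N.≤ i → sumTo (suc (suc i)) (λ l → U j l * P l m) ≡ U (suc j) m
    inner m le = begin
      sumTo (suc (suc i)) (λ l → U j l * P l m)
        ≡⟨ sym (sum-pad (suc (suc i)) K _ (s≤s (s≤s (NP.m≤m+n i j))) (λ l q → trans (cong (U j l *_) (proj₂ (P-tridiagonal l m) (NP.≤-trans (s≤s (s≤s le)) q))) (QP.*-zeroʳ (U j l)))) ⟩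
      sumTo K (λ l → U j l * P l m)
        ≡⟨ sym (lmul-pad U P Ulow j m K (s≤s (NP.≤-trans (NP.m≤n+m j i) (NP.n≤1+n (i N.+ j))))) ⟩
      lmul U P j m
        ≡⟨ U-production j m ⟩
      U (suc j) m ∎

  TU-sum : ∀ m l K → m N.< K → sumTo K (λ a → T m a * U a l) ≡ δ m l
  TU-sum m l K p = trans (sym (lmul-pad T U Tlow m l K p)) (TU≡δ m l)

  orthogonal : ∀ m n → m ≢ n → Lfun μ (m N.+ n) (row T m ⊛ row T n) ≡ 0ℚ
  orthogonal m n ne = begin
    sumTo (suc N) (λ l → (row T m ⊛ row T n) l * μ l)
      ≡⟨ sum-cong-< (suc N) (λ l p → trans (sum-*ʳ (suc l) (μ l) _) (sum-cong-< (suc l) (λ a q → cong (λ z → T m a * T n (l ∸ a) * μ z) (sym (NP.m+[n∸m]≡n (NP.≤-pred q)))))) ⟩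
    sumTo (suc N) (λ l → sumTo (suc l) (λ a → G a (l ∸ a)))
      ≡⟨ sum-triangle N (λ a b _ → G a b) ⟩
    sumTo (suc N) (λ a → sumTo (suc (N ∸ a)) (λ b → G a b))
      ≡⟨ sum-cong-< (suc N) (λ a p → sym (sum-pad (suc (N ∸ a)) (suc N) _ (s≤s (NP.m∸n≤m N a)) (λ b q → Gz a b q))) ⟩
    sumTo (suc N) (λ a → sumTo (suc N) (λ b → G a b))
      ≡⟨ sum-cong-< (suc N) (λ a p → sum-cong (suc N) (λ b → trans (cong (T m a * T n b *_) (trans (hankel a b) (sym (gram-pad (suc N) a b p))))
           (trans (sum-*ˡ (suc N) (T m a * T n b) _) (sum-cong (suc N) (λ l → QS.solve 5 (λ x y u v h → x QS.:* y QS.:* (u QS.:* v QS.:* h) QS.:= (x QS.:* u) QS.:* ((y QS.:* v) QS.:* h)) refl (T m a) (T n b) (U a l) (U b l) (norm l)))))) ⟩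
    sumTo (suc N) (λ a → sumTo (suc N) (λ b → sumTo (suc N) (λ l → (T m a * U a l) * ((T n b * U b l) * norm l))))
      ≡⟨ sum-cong (suc N) (λ a → sum-swap (suc N) (suc N) _) ⟩
    sumTo (suc N) (λ a → sumTo (suc N) (λ l → sumTo (suc N) (λ b → (T m a * U a l) * ((T n b * U b l) * norm l))))
      ≡⟨ sum-swap (suc N) (suc N) _ ⟩
    sumTo (suc N) (λ l → sumTo (suc N) (λ a → sumTo (suc N) (λ b → (T m a * U a l) * ((T n b * U b l) * norm l))))
      ≡⟨ sum-cong (suc N) (λ l → trans (sum-cong (suc N) (λ a → sym (sum-*ˡ (suc N) (T m a * U a l) _)))
           (trans (sym (sum-*ʳ (suc N) _ _)) (cong₂ _*_ (TU-sum m l (suc N) (s≤s (NP.m≤m+n m n)))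
              (trans (sym (sum-*ʳ (suc N) (norm l) _)) (cong (_* norm l) (TU-sum n l (suc N) (s≤s (NP.m≤n+m n m)))))))) ⟩
    sumTo (suc N) (λ l → δ m l * (δ n l * norm l))
      ≡⟨ sum-zero (suc N) _ (λ l _ → dz l) ⟩
    0ℚ ∎
    where
    N : ℕ
    N = m N.+ n
    G : ℕ → ℕ → ℚ
    G a b = T m a * T n b * μ (a N.+ b)
    Gz : ∀ a b → suc (N ∸ a) N.≤ b → G a b ≡ 0ℚ
    Gz a b q with a N.≤? m
    ... | yes am = trans (cong (λ z → T m a * z * μ (a N.+ b)) (Tlow n b (NP.<-≤-trans (s≤s (subst (n N.≤_) (sym (NP.+-∸-comm n am)) (NP.m≤n+m n (m ∸ a)))) q)))
                    (trans (cong (_* μ (a N.+ b)) (QP.*-zeroʳ (T m a))) (QP.*-zeroˡ (μ (a N.+ b))))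
    ... | no am = trans (cong (λ z → z * T n b * μ (a N.+ b)) (Tlow m a (NP.≰⇒> am)))
                    (trans (cong (_* μ (a N.+ b)) (QP.*-zeroˡ (T n b))) (QP.*-zeroˡ (μ (a N.+ b))))
    dz : ∀ l → δ m l * (δ n l * norm l) ≡ 0ℚ
    dz l with m N.≟ l
    ... | yes refl = trans (cong (δ m m *_) (trans (cong (_* norm m) (δ-off n m (λ e → ne (sym e)))) (QP.*-zeroˡ (norm m)))) (QP.*-zeroʳ (δ m m))
    ... | no nml = trans (cong (_* (δ n l * norm l)) (δ-off m l nml)) (QP.*-zeroˡ (δ n l * norm l))

  μ-isMoment : IsMomentSeq T μ
  μ-isMoment = U00 , orthogonal

  -- Uniqueness: L(P_n) = δ n 0 determines L(y^n) by inverting T.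
  row0-unit : ∀ g l → (row T 0 ⊛ g) l ≡ g l
  row0-unit g l = trans (sum-first l _) (trans (cong₂ _+_ (trans (cong (_* g l) T00) (QP.*-identityˡ (g l)))
                  (sum-zero l _ (λ a _ → trans (cong (_* g (l ∸ suc a)) (Tlow 0 (suc a) (s≤s z≤n))) (QP.*-zeroˡ (g (l ∸ suc a)))))) (QP.+-identityʳ (g l)))

  moment-unique : ∀ ν → IsMomentSeq T ν → ∀ j → ν j ≡ U j 0
  moment-unique ν (ν0 , ort) j = begin
    ν j ≡⟨ sym (trans (sum-single (suc j) j _ NP.≤-refl (λ l _ ne → trans (cong (_* ν l) (δ-off j l (λ e → ne (sym e)))) (QP.*-zeroˡ (ν l))))
                 (trans (cong (_* ν j) (δ-diag j)) (QP.*-identityˡ (ν j)))) ⟩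
    sumTo (suc j) (λ l → δ j l * ν l) ≡⟨ sum-cong (suc j) (λ l → cong (_* ν l) (sym (UT≡δ j l))) ⟩
    sumTo (suc j) (λ l → sumTo (suc j) (λ n → U j n * T n l) * ν l) ≡⟨ sum-cong (suc j) (λ l → trans (sum-*ʳ (suc j) (ν l) _) (sum-cong (suc j) (λ n → QP.*-assoc (U j n) (T n l) (ν l)))) ⟩
    sumTo (suc j) (λ l → sumTo (suc j) (λ n → U j n * (T n l * ν l))) ≡⟨ sum-swap (suc j) (suc j) _ ⟩
    sumTo (suc j) (λ n → sumTo (suc j) (λ l → U j n * (T n l * ν l))) ≡⟨ sum-cong-< (suc j) (λ n p → trans (sym (sum-*ˡ (suc j) (U j n) _)) (cong (U j n *_) (trans (sν-ext n p) (sν n)))) ⟩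
    sumTo (suc j) (λ n → U j n * δ n 0) ≡⟨ sum-cong (suc j) (λ n → cong (U j n *_) (sym (QP.*-identityʳ (δ n 0)))) ⟩
    sumTo (suc j) (λ n → U j n * (δ n 0 * 1ℚ)) ≡⟨ sum-δ U j 0 1ℚ Ulow ⟩
    U j 0 * 1ℚ ≡⟨ QP.*-identityʳ (U j 0) ⟩
    U j 0 ∎
    where
    sν-ext : ∀ n → n N.< suc j → sumTo (suc j) (λ l → T n l * ν l) ≡ sumTo (suc n) (λ l → T n l * ν l)
    sν-ext n p = sum-pad (suc n) (suc j) _ p (λ l q → trans (cong (_* ν l) (Tlow n l q)) (QP.*-zeroˡ (ν l)))
    sν : ∀ n → sumTo (suc n) (λ l → T n l * ν l) ≡ δ n 0
    sν zero = trans (cong (λ z → 0ℚ + z * ν 0) T00) (trans (cong (λ z → 0ℚ + 1ℚ * z) ν0) refl)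
    sν (suc n) = trans (sym (sum-cong (suc (suc n)) (λ l → cong (_* ν l) (row0-unit (row T (suc n)) l)))) (ort 0 (suc n) (λ ()))

-- First, U is the inverse of T: b and B are mutually
-- inverse under composition (b∘B = z since p1/p2 ∘ B = e^z, B∘b = z since
-- e^b = p1/p2), and a·(Fm∘b) = 1, Fm·(a∘B) = 1 follow from Q∘b = 1/p2 after
-- taking square roots.  Second, Fm and B satisfy the Riccati-type equations
--   Fm' = Fm (r + r(1+2r) B),   B' = 1 + (1+4r) B + 2r(1+2r) B²,
-- so ERAProduction applies, and MomentsFromProduction yields the moments.
module Theorem11 (r : ℚ) where

  tr : ℚ
  tr = two * r

  c2r : FPS
  c2r = cst tr

  cr : FPS
  cr = cst r

  p2 : FPS
  p2 = poly1 tr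

  p1 : FPS
  p1 = poly1 (1ℚ + tr)

  M : FPS
  M = p1 ⊛ recip1 p2

  e : FPS
  e = expS

  Qr : FPS
  Qr = Q r

  s : FPS
  s = sqrt1 Qr

  Fm : FPS
  Fm = recip1 s

  ι : FPS
  ι = recip1 Qr

  B : FPS
  B = bU r

  t : FPS
  t = sqrt1 p2

  a : FPS
  a = aT r

  b : FPS
  b = bT r

  Q-const : Qr 0 ≡ 1ℚ
  Q-const = trans (cong (1ℚ +_) (QP.*-zeroʳ tr)) refl

  Q-eq : Qr ≗ (cst1 ⊕ (c2r ⊛ (cst1 ⊖ e)))
  Q-eq n = cong₂ _+_ (one≡cst1 n) (trans (cong (tr *_) (cong (_- e n) (one≡cst1 n))) (scale-cst tr (cst1 ⊖ e) n))

  M-const : M 0 ≡ 1ℚ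
  M-const = refl

  b0 : b 0 ≡ 0ℚ
  b0 = refl

  B0 : B 0 ≡ 0ℚ
  B0 = refl

  M·p2≡p1 : (M ⊛ p2) ≗ p1
  M·p2≡p1 = ≗R.begin
    (p1 ⊛ recip1 p2) ⊛ p2 ≗R.≈⟨ ⊛-assoc p1 (recip1 p2) p2 ⟩
    p1 ⊛ (recip1 p2 ⊛ p2) ≗R.≈⟨ ⊛-congʳ p1 (recip1-invˡ p2 refl) ⟩
    p1 ⊛ one ≗R.≈⟨ ⊛-identityʳ p1 ⟩
    p1 ≗R.∎

  -- e^b = M: both solve y' = (M'/M) y with y(0) = 1, since b' = M'/M.
  D-b : D b ≗ (recip1 M ⊛ D M)
  D-b = D-log1 M M-const

  exp∘b≡M : compose e b ≗ M
  exp∘b≡M = ⊖-zero (compose e b) M (ode-unique h Δ DΔ refl)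
    where
    Δ : FPS
    Δ = compose e b ⊖ M
    h : FPS
    h = recip1 M ⊛ D M
    DΔ : D Δ ≗ (h ⊛ Δ)
    DΔ = ≗R.begin
      D Δ ≗R.≈⟨ D-⊖ (compose e b) M ⟩
      D (compose e b) ⊖ D M ≗R.≈⟨ (λ n → cong₂ _-_ (D-exp b b0 n) refl) ⟩
      (compose e b ⊛ D b) ⊖ D M ≗R.≈⟨ (λ n → cong₂ _-_ (⊛-congʳ (compose e b) D-b n) (sym (trans (⊛-congˡ (D M) (recip1-invʳ M M-const) n) (⊛-identityˡ (D M) n)))) ⟩
      (compose e b ⊛ h) ⊖ ((M ⊛ recip1 M) ⊛ D M) ≗R.≈⟨ (λ n → fsolve 4 (λ E M R DM → E :* (R :* DM) :- (M :* R) :* DM := (R :* DM) :* (E :- M)) (λ _ → refl) (compose e b) M (recip1 M) (D M) n) ⟩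
      h ⊛ Δ ≗R.∎

  -- Q ∘ b = 1 + 2r(1 - M) = 1/p2, hence ι ∘ b = p2 and B ∘ b = (M - 1) p2 = z.
  Q∘b : compose Qr b ≗ (cst1 ⊕ (c2r ⊛ (cst1 ⊖ M)))
  Q∘b = ≗R.begin
    compose Qr b ≗R.≈⟨ compose-cong Q-eq (λ _ → refl) ⟩
    compose (cst1 ⊕ (c2r ⊛ (cst1 ⊖ e))) b ≗R.≈⟨ compose-⊕ cst1 (c2r ⊛ (cst1 ⊖ e)) b ⟩
    compose cst1 b ⊕ compose (c2r ⊛ (cst1 ⊖ e)) b ≗R.≈⟨ (λ n → cong₂ _+_ (compose-cst 1ℚ b n) (compose-mult c2r (cst1 ⊖ e) b b0 n)) ⟩
    cst1 ⊕ (compose c2r b ⊛ compose (cst1 ⊖ e) b) ≗R.≈⟨ (λ n → cong (cst1 n +_) (⊛-cong (compose-cst tr b) (≗-trans (compose-⊖ cst1 e b) (λ m → cong₂ _-_ (compose-cst 1ℚ b m) (exp∘b≡M m))) n)) ⟩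
    cst1 ⊕ (c2r ⊛ (cst1 ⊖ M)) ≗R.∎

  p1-expr : p1 ≗ (cst1 ⊕ ((cst1 ⊕ c2r) ⊛ X))
  p1-expr = ≗-trans (poly1-eq (1ℚ + tr)) (λ n → cong (cst1 n +_) (⊛-congˡ X (cst-+ 1ℚ tr) n))

  Q∘b·p2≡1 : (compose Qr b ⊛ p2) ≗ one
  Q∘b·p2≡1 = ≗R.begin
    compose Qr b ⊛ p2 ≗R.≈⟨ ⊛-congˡ p2 Q∘b ⟩
    (cst1 ⊕ (c2r ⊛ (cst1 ⊖ M))) ⊛ p2 ≗R.≈⟨ (λ n → fsolve 4 (λ c2r M P Q → (con 1ℚ :+ c2r :* (con 1ℚ :- M)) :* P := (P :+ c2r :* P) :- c2r :* (M :* P)) (λ _ → refl) c2r M p2 p1 n) ⟩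
    (p2 ⊕ (c2r ⊛ p2)) ⊖ (c2r ⊛ (M ⊛ p2)) ≗R.≈⟨ (λ n → cong (λ z → (p2 ⊕ (c2r ⊛ p2)) n - z) (⊛-congʳ c2r M·p2≡p1 n)) ⟩
    (p2 ⊕ (c2r ⊛ p2)) ⊖ (c2r ⊛ p1) ≗R.≈⟨ (λ n → cong₂ _-_ (cong₂ _+_ (poly1-eq tr n) (⊛-congʳ c2r (poly1-eq tr) n)) (⊛-congʳ c2r p1-expr n)) ⟩
    ((cst1 ⊕ (c2r ⊛ X)) ⊕ (c2r ⊛ (cst1 ⊕ (c2r ⊛ X)))) ⊖ (c2r ⊛ (cst1 ⊕ ((cst1 ⊕ c2r) ⊛ X)))
      ≗R.≈⟨ (λ n → fsolve 2 (λ c2r X → ((con 1ℚ :+ c2r :* X) :+ c2r :* (con 1ℚ :+ c2r :* X)) :- c2r :* (con 1ℚ :+ (con 1ℚ :+ c2r) :* X) := con 1ℚ) (λ _ → refl) c2r X n) ⟩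
    cst1 ≗R.≈⟨ ≗-sym one≡cst1 ⟩
    one ≗R.∎

  ι·Q≡1 : (ι ⊛ Qr) ≗ one
  ι·Q≡1 = recip1-invˡ Qr Q-const

  ι∘b≡p2 : compose ι b ≗ p2
  ι∘b≡p2 = inv-unique (compose Qr b) (compose ι b) p2 (≗-trans (⊛-comm (compose Qr b) (compose ι b)) (compose-inv ι Qr b b0 ι·Q≡1)) Q∘b·p2≡1

  B∘b≡X : compose B b ≗ X
  B∘b≡X = ≗R.begin
    compose B b ≗R.≈⟨ compose-mult (e ⊖ one) ι b b0 ⟩
    compose (e ⊖ one) b ⊛ compose ι b ≗R.≈⟨ ⊛-cong (≗-trans (compose-⊖ e one b) (λ n → cong₂ _-_ (exp∘b≡M n) (compose-one b n))) ι∘b≡p2 ⟩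
    (M ⊖ one) ⊛ p2 ≗R.≈⟨ (λ n → trans (⊛-congˡ {M ⊖ one} {M ⊖ cst1} p2 (λ m → cong (λ z → M m - z) (one≡cst1 m)) n) (fsolve 3 (λ M O P → (M :- O) :* P := M :* P :- O :* P) (λ _ → refl) M cst1 p2 n)) ⟩
    (M ⊛ p2) ⊖ (cst1 ⊛ p2) ≗R.≈⟨ (λ n → cong₂ _-_ (M·p2≡p1 n) (trans (⊛-congˡ p2 (≗-sym one≡cst1) n) (⊛-identityˡ p2 n))) ⟩
    p1 ⊖ p2 ≗R.≈⟨ (λ n → cong₂ _-_ (p1-expr n) (poly1-eq tr n)) ⟩
    (cst1 ⊕ ((cst1 ⊕ c2r) ⊛ X)) ⊖ (cst1 ⊕ (c2r ⊛ X)) ≗R.≈⟨ (λ n → fsolve 2 (λ c2r X → (con 1ℚ :+ (con 1ℚ :+ c2r) :* X) :- (con 1ℚ :+ c2r :* X) := con 1ℚ :* X) (λ _ → refl) c2r X n) ⟩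
    cst1 ⊛ X ≗R.≈⟨ ⊛-congˡ X (≗-sym one≡cst1) ⟩
    one ⊛ X ≗R.≈⟨ ⊛-identityˡ X ⟩
    X ≗R.∎

  -- Square roots: a = 1/t with t² = p2 and Fm = 1/s with s² = Q; since
  -- (s∘b)² t² = (Q∘b) p2 = 1 we get (s∘b) t = 1, hence a·(Fm∘b) = 1.
  s²≡Q : (s ⊛ s) ≗ Qr
  s²≡Q = sqrt1-sq Qr Q-const

  t²≡p2 : (t ⊛ t) ≗ p2
  t²≡p2 = sqrt1-sq p2 refl

  Fm·s≡1 : (Fm ⊛ s) ≗ one
  Fm·s≡1 = recip1-invˡ s refl

  a·t≡1 : (a ⊛ t) ≗ one
  a·t≡1 = recip1-invˡ t refl

  a·Fm∘b≡1 : (a ⊛ compose Fm b) ≗ one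
  a·Fm∘b≡1 = ≗R.begin
    a ⊛ compose Fm b ≗R.≈⟨ ≗-sym (⊛-identityʳ (a ⊛ compose Fm b)) ⟩
    (a ⊛ compose Fm b) ⊛ one ≗R.≈⟨ ⊛-congʳ (a ⊛ compose Fm b) (≗-sym ct) ⟩
    (a ⊛ compose Fm b) ⊛ (c ⊛ t) ≗R.≈⟨ (λ n → fsolve 4 (λ a F c t → (a :* F) :* (c :* t) := (a :* t) :* (F :* c)) (λ _ → refl) a (compose Fm b) c t n) ⟩
    (a ⊛ t) ⊛ (compose Fm b ⊛ c) ≗R.≈⟨ ⊛-cong a·t≡1 (compose-inv Fm s b b0 Fm·s≡1) ⟩
    one ⊛ one ≗R.≈⟨ ⊛-identityˡ one ⟩
    one ≗R.∎
    where
    c : FPS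
    c = compose s b
    ct : (c ⊛ t) ≗ one
    ct = squares-inverse⇒inverse c t refl refl (≗R.begin
      (c ⊛ c) ⊛ (t ⊛ t) ≗R.≈⟨ ⊛-cong (≗-trans (≗-sym (compose-mult s s b b0)) (compose-cong s²≡Q (λ _ → refl))) t²≡p2 ⟩
      compose Qr b ⊛ p2 ≗R.≈⟨ Q∘b·p2≡1 ⟩
      one ≗R.∎)

  -- The converse compositions: 1/Q = 1 + 2rB and e = 1 + BQ give p2 ∘ B = 1/Q,
  -- p1 ∘ B = e/Q, hence M ∘ B = e and b ∘ B = ln e = z; then Fm·(a∘B) = 1 as above.
  B-expr : B ≗ ((e ⊖ cst1) ⊛ ι)
  B-expr = ⊛-congˡ ι (λ n → cong (λ z → e n - z) (one≡cst1 n))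

  ι·Q≡cst1 : (ι ⊛ Qr) ≗ cst1
  ι·Q≡cst1 = ≗-trans ι·Q≡1 one≡cst1

  Q·[1+2rB]≡1 : (Qr ⊛ (cst1 ⊕ (c2r ⊛ B))) ≗ one
  Q·[1+2rB]≡1 = ≗R.begin
    Qr ⊛ (cst1 ⊕ (c2r ⊛ B)) ≗R.≈⟨ ⊛-congʳ Qr (λ n → cong (cst1 n +_) (⊛-congʳ c2r B-expr n)) ⟩
    Qr ⊛ (cst1 ⊕ (c2r ⊛ ((e ⊖ cst1) ⊛ ι))) ≗R.≈⟨ (λ n → fsolve 4 (λ Q c2r E I → Q :* (con 1ℚ :+ c2r :* ((E :- con 1ℚ) :* I)) := Q :+ (c2r :* (E :- con 1ℚ)) :* (I :* Q)) (λ _ → refl) Qr c2r e ι n) ⟩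
    Qr ⊕ ((c2r ⊛ (e ⊖ cst1)) ⊛ (ι ⊛ Qr)) ≗R.≈⟨ (λ n → cong₂ _+_ (Q-eq n) (⊛-congʳ (c2r ⊛ (e ⊖ cst1)) ι·Q≡cst1 n)) ⟩
    (cst1 ⊕ (c2r ⊛ (cst1 ⊖ e))) ⊕ ((c2r ⊛ (e ⊖ cst1)) ⊛ cst1) ≗R.≈⟨ (λ n → fsolve 2 (λ c2r E → (con 1ℚ :+ c2r :* (con 1ℚ :- E)) :+ (c2r :* (E :- con 1ℚ)) :* con 1ℚ := con 1ℚ) (λ _ → refl) c2r e n) ⟩
    cst1 ≗R.≈⟨ ≗-sym one≡cst1 ⟩
    one ≗R.∎

  ι≡1+2rB : ι ≗ (cst1 ⊕ (c2r ⊛ B))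
  ι≡1+2rB = inv-unique Qr ι (cst1 ⊕ (c2r ⊛ B)) (≗-trans (⊛-comm Qr ι) ι·Q≡1) Q·[1+2rB]≡1

  e≡1+BQ : e ≗ (cst1 ⊕ (B ⊛ Qr))
  e≡1+BQ n = sym (begin
    cst1 n + (B ⊛ Qr) n ≡⟨ cong (cst1 n +_) (⊛-congˡ Qr B-expr n) ⟩
    cst1 n + (((e ⊖ cst1) ⊛ ι) ⊛ Qr) n ≡⟨ cong (cst1 n +_) (⊛-assoc (e ⊖ cst1) ι Qr n) ⟩
    cst1 n + ((e ⊖ cst1) ⊛ (ι ⊛ Qr)) n ≡⟨ cong (cst1 n +_) (⊛-congʳ (e ⊖ cst1) ι·Q≡cst1 n) ⟩
    cst1 n + ((e ⊖ cst1) ⊛ cst1) n ≡⟨ fsolve 1 (λ E → con 1ℚ :+ (E :- con 1ℚ) :* con 1ℚ := E) (λ _ → refl) e n ⟩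
    e n ∎)

  p2∘B≡ι : compose p2 B ≗ ι
  p2∘B≡ι = ≗-trans (compose-poly1 tr B B0) (≗-sym ι≡1+2rB)

  p1∘B≡ιe : compose p1 B ≗ (ι ⊛ e)
  p1∘B≡ιe = ≗R.begin
    compose p1 B ≗R.≈⟨ compose-poly1 (1ℚ + tr) B B0 ⟩
    cst1 ⊕ (cst (1ℚ + tr) ⊛ B) ≗R.≈⟨ (λ n → cong (cst1 n +_) (⊛-congˡ B (cst-+ 1ℚ tr) n)) ⟩
    cst1 ⊕ ((cst1 ⊕ c2r) ⊛ B) ≗R.≈⟨ (λ n → fsolve 2 (λ c2r B → con 1ℚ :+ (con 1ℚ :+ c2r) :* B := (con 1ℚ :+ c2r :* B) :+ B) (λ _ → refl) c2r B n) ⟩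
    (cst1 ⊕ (c2r ⊛ B)) ⊕ B ≗R.≈⟨ (λ n → cong (_+ B n) (sym (ι≡1+2rB n))) ⟩
    ι ⊕ B ≗R.≈⟨ (λ n → fsolve 3 (λ I B Q → I :+ B := I :* con 1ℚ :+ B :* con 1ℚ) (λ _ → refl) ι B Qr n) ⟩
    (ι ⊛ cst1) ⊕ (B ⊛ cst1) ≗R.≈⟨ (λ n → cong ((ι ⊛ cst1) n +_) (⊛-congʳ B (≗-sym ι·Q≡cst1) n)) ⟩
    (ι ⊛ cst1) ⊕ (B ⊛ (ι ⊛ Qr)) ≗R.≈⟨ (λ n → fsolve 3 (λ I B Q → I :* con 1ℚ :+ B :* (I :* Q) := I :* (con 1ℚ :+ B :* Q)) (λ _ → refl) ι B Qr n) ⟩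
    ι ⊛ (cst1 ⊕ (B ⊛ Qr)) ≗R.≈⟨ ⊛-congʳ ι (≗-sym e≡1+BQ) ⟩
    ι ⊛ e ≗R.∎

  [1/p2]∘B≡Q : compose (recip1 p2) B ≗ Qr
  [1/p2]∘B≡Q = inv-unique ι (compose (recip1 p2) B) Qr
    (≗-trans (⊛-congˡ (compose (recip1 p2) B) (≗-sym p2∘B≡ι)) (≗-trans (⊛-comm (compose p2 B) (compose (recip1 p2) B)) (compose-inv (recip1 p2) p2 B B0 (recip1-invˡ p2 refl))))
    ι·Q≡1

  M∘B≡e : compose M B ≗ e
  M∘B≡e = ≗R.begin
    compose M B ≗R.≈⟨ compose-mult p1 (recip1 p2) B B0 ⟩
    compose p1 B ⊛ compose (recip1 p2) B ≗R.≈⟨ ⊛-cong p1∘B≡ιe [1/p2]∘B≡Q ⟩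
    (ι ⊛ e) ⊛ Qr ≗R.≈⟨ (λ n → fsolve 3 (λ I E Q → (I :* E) :* Q := E :* (I :* Q)) (λ _ → refl) ι e Qr n) ⟩
    e ⊛ (ι ⊛ Qr) ≗R.≈⟨ ⊛-congʳ e ι·Q≡1 ⟩
    e ⊛ one ≗R.≈⟨ ⊛-identityʳ e ⟩
    e ≗R.∎

  b∘B≡X : compose b B ≗ X
  b∘B≡X = ≗R.begin
    compose (compose logS (M ⊖ one)) B ≗R.≈⟨ compose-assoc logS (M ⊖ one) B refl B0 ⟩
    compose logS (compose (M ⊖ one) B) ≗R.≈⟨ compose-cong {logS} {logS} (λ _ → refl) (≗-trans (compose-⊖ M one B) (λ n → cong₂ _-_ (M∘B≡e n) (compose-one B n))) ⟩
    log1 expS ≗R.≈⟨ log1-exp≡X ⟩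
    X ≗R.∎

  -- Fm · (a ∘ B) = 1, as for a·(Fm∘b) using (t∘B)² = 1/Q.
  Fm·a∘B≡1 : (Fm ⊛ compose a B) ≗ one
  Fm·a∘B≡1 = ≗R.begin
    Fm ⊛ compose a B ≗R.≈⟨ ≗-sym (⊛-identityʳ (Fm ⊛ compose a B)) ⟩
    (Fm ⊛ compose a B) ⊛ one ≗R.≈⟨ ⊛-congʳ (Fm ⊛ compose a B) (≗-sym cs) ⟩
    (Fm ⊛ compose a B) ⊛ (c ⊛ s) ≗R.≈⟨ (λ n → fsolve 4 (λ F A c s → (F :* A) :* (c :* s) := (F :* s) :* (A :* c)) (λ _ → refl) Fm (compose a B) c s n) ⟩
    (Fm ⊛ s) ⊛ (compose a B ⊛ c) ≗R.≈⟨ ⊛-cong Fm·s≡1 (compose-inv a t B B0 a·t≡1) ⟩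
    one ⊛ one ≗R.≈⟨ ⊛-identityˡ one ⟩
    one ≗R.∎
    where
    c : FPS
    c = compose t B
    cs : (c ⊛ s) ≗ one
    cs = squares-inverse⇒inverse c s refl refl (≗R.begin
      (c ⊛ c) ⊛ (s ⊛ s) ≗R.≈⟨ ⊛-cong (≗-trans (≗-sym (compose-mult t t B B0)) (≗-trans (compose-cong t²≡p2 (λ _ → refl)) p2∘B≡ι)) s²≡Q ⟩
      ι ⊛ Qr ≗R.≈⟨ ι·Q≡1 ⟩
      one ≗R.∎)

  TU≡δ : ∀ n k → lmul (ERA a b) (ERA Fm B) n k ≡ δ n k
  TU≡δ = ERA-inverse a b Fm B b0 B0 a·Fm∘b≡1 B∘b≡X

  UT≡δ : ∀ n k → lmul (ERA Fm B) (ERA a b) n k ≡ δ n k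
  UT≡δ = ERA-inverse Fm B a b B0 b0 Fm·a∘B≡1 b∘B≡X

  -- From Q' = -2r e and e = 1 + BQ:
  --   B' Q = e + 2r e B,  so  B' = (1/Q)·e·(1 + 2rB) = (1/Q + B)(1/Q),
  -- a quadratic in B since 1/Q = 1 + 2rB.  From s² = Q: s s' = -r e, so
  --   Fm' = -Fm² s' = Fm·r·e/Q = Fm·r·(1/Q + B).
  c2r≡2·r : c2r ≗ (cst two ⊛ cr)
  c2r≡2·r = cst-* two r

  D-Q : D Qr ≗ negS (c2r ⊛ e)
  D-Q n = begin
    D Qr n ≡⟨ D-⊕ one (scale tr (one ⊖ expS)) n ⟩
    D one n + D (scale tr (one ⊖ expS)) n ≡⟨ cong₂ _+_ (D-one n) (trans (D-scale tr (one ⊖ expS) n) (cong (tr *_) (trans (D-⊖ one expS n) (cong₂ _-_ (D-one n) (D-expS n))))) ⟩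
    0ℚ + tr * (0ℚ - e n) ≡⟨ QS.solve 2 (λ t x → QS.con 0ℚ QS.:+ t QS.:* (QS.con 0ℚ QS.:- x) QS.:= QS.:- (t QS.:* x)) refl tr (e n) ⟩
    - (tr * e n) ≡⟨ cong -_ (scale-cst tr e n) ⟩
    negS (c2r ⊛ e) n ∎

  ι·e≡ι+B : (ι ⊛ e) ≗ (ι ⊕ B)
  ι·e≡ι+B = ≗R.begin
    ι ⊛ e ≗R.≈⟨ ⊛-congʳ ι e≡1+BQ ⟩
    ι ⊛ (cst1 ⊕ (B ⊛ Qr)) ≗R.≈⟨ (λ n → fsolve 3 (λ I B Q → I :* (con 1ℚ :+ B :* Q) := I :+ B :* (I :* Q)) (λ _ → refl) ι B Qr n) ⟩
    ι ⊕ (B ⊛ (ι ⊛ Qr)) ≗R.≈⟨ (λ n → cong (ι n +_) (trans (⊛-congʳ B ι·Q≡cst1 n) (fsolve 1 (λ B → B :* con 1ℚ := B) (λ _ → refl) B n))) ⟩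
    ι ⊕ B ≗R.∎

  e≡D[B·Q] : e ≗ ((D B ⊛ Qr) ⊕ (B ⊛ negS (c2r ⊛ e)))
  e≡D[B·Q] = ≗R.begin
    e ≗R.≈⟨ ≗-sym D-expS ⟩
    D e ≗R.≈⟨ D-cong e≡1+BQ ⟩
    D (cst1 ⊕ (B ⊛ Qr)) ≗R.≈⟨ D-⊕ cst1 (B ⊛ Qr) ⟩
    D cst1 ⊕ D (B ⊛ Qr) ≗R.≈⟨ (λ n → cong₂ _+_ (D-cst 1ℚ n) (D-⊛ B Qr n)) ⟩
    zeroS ⊕ ((D B ⊛ Qr) ⊕ (B ⊛ D Qr)) ≗R.≈⟨ (λ n → trans (QP.+-identityˡ _) (cong ((D B ⊛ Qr) n +_) (⊛-congʳ B D-Q n))) ⟩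
    (D B ⊛ Qr) ⊕ (B ⊛ negS (c2r ⊛ e)) ≗R.∎

  DB·Q : (D B ⊛ Qr) ≗ (e ⊕ (B ⊛ (c2r ⊛ e)))
  DB·Q n = begin
    (D B ⊛ Qr) n ≡⟨ QS.solve 3 (λ d x e → d QS.:= (d QS.:+ x) QS.:- x) refl ((D B ⊛ Qr) n) ((B ⊛ negS (c2r ⊛ e)) n) (e n) ⟩
    ((D B ⊛ Qr) n + (B ⊛ negS (c2r ⊛ e)) n) - (B ⊛ negS (c2r ⊛ e)) n ≡⟨ cong₂ _-_ (sym (e≡D[B·Q] n)) (fsolve 3 (λ B c2r e → B :* (:- (c2r :* e)) := :- (B :* (c2r :* e))) (λ _ → refl) B c2r e n) ⟩
    e n - - (B ⊛ (c2r ⊛ e)) n ≡⟨ QS.solve 2 (λ a b → a QS.:- (QS.:- b) QS.:= a QS.:+ b) refl (e n) ((B ⊛ (c2r ⊛ e)) n) ⟩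
    e n + (B ⊛ (c2r ⊛ e)) n ∎

  D-B-expr : D B ≗ ((cst1 ⊕ ((cst1 ⊕ (cst two ⊛ c2r)) ⊛ B)) ⊕ (((c2r ⊛ c2r) ⊕ c2r) ⊛ (B ⊛ B)))
  D-B-expr = ≗R.begin
    D B ≗R.≈⟨ ≗-sym (⊛-identityʳ (D B)) ⟩
    D B ⊛ one ≗R.≈⟨ ⊛-congʳ (D B) (≗-sym (≗-trans (⊛-comm Qr ι) ι·Q≡1)) ⟩
    D B ⊛ (Qr ⊛ ι) ≗R.≈⟨ ≗-sym (⊛-assoc (D B) Qr ι) ⟩
    (D B ⊛ Qr) ⊛ ι ≗R.≈⟨ ⊛-congˡ ι DB·Q ⟩
    (e ⊕ (B ⊛ (c2r ⊛ e))) ⊛ ι ≗R.≈⟨ (λ n → fsolve 4 (λ e B c2r I → (e :+ B :* (c2r :* e)) :* I := (I :* e) :* (con 1ℚ :+ c2r :* B)) (λ _ → refl) e B c2r ι n) ⟩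
    (ι ⊛ e) ⊛ (cst1 ⊕ (c2r ⊛ B)) ≗R.≈⟨ ⊛-cong ι·e≡ι+B (≗-sym ι≡1+2rB) ⟩
    (ι ⊕ B) ⊛ ι ≗R.≈⟨ (λ n → ⊛-cong {ι ⊕ B} {(cst1 ⊕ (c2r ⊛ B)) ⊕ B} {ι} {cst1 ⊕ (c2r ⊛ B)} (λ m → cong (_+ B m) (ι≡1+2rB m)) ι≡1+2rB n) ⟩
    ((cst1 ⊕ (c2r ⊛ B)) ⊕ B) ⊛ (cst1 ⊕ (c2r ⊛ B)) ≗R.≈⟨ (λ n → fsolve 2 (λ c2r B → ((con 1ℚ :+ c2r :* B) :+ B) :* (con 1ℚ :+ c2r :* B) := (con 1ℚ :+ (con 1ℚ :+ con two :* c2r) :* B) :+ (c2r :* c2r :+ c2r) :* (B :* B)) (λ _ → refl) c2r B n) ⟩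
    (cst1 ⊕ ((cst1 ⊕ (cst two ⊛ c2r)) ⊛ B)) ⊕ (((c2r ⊛ c2r) ⊕ c2r) ⊛ (B ⊛ B)) ≗R.∎

  s·Ds : (s ⊛ D s) ≗ negS (cr ⊛ e)
  s·Ds = ≗R.begin
    s ⊛ D s ≗R.≈⟨ (λ n → fsolve 2 (λ s d → s :* d := con half :* (d :* s :+ s :* d)) (λ _ → refl) s (D s) n) ⟩
    cst half ⊛ ((D s ⊛ s) ⊕ (s ⊛ D s)) ≗R.≈⟨ ⊛-congʳ (cst half) (≗-trans (≗-sym (D-⊛ s s)) (≗-trans (D-cong s²≡Q) D-Q)) ⟩
    cst half ⊛ negS (c2r ⊛ e) ≗R.≈⟨ ⊛-congʳ (cst half) (λ n → cong -_ (⊛-congˡ e c2r≡2·r n)) ⟩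
    cst half ⊛ negS ((cst two ⊛ cr) ⊛ e) ≗R.≈⟨ (λ n → fsolve 2 (λ cr e → con half :* (:- ((con two :* cr) :* e)) := :- (cr :* e)) (λ _ → refl) cr e n) ⟩
    negS (cr ⊛ e) ≗R.∎

  Fm²≡ι : (Fm ⊛ Fm) ≗ ι
  Fm²≡ι = inv-unique Qr (Fm ⊛ Fm) ι
    (≗R.begin
      Qr ⊛ (Fm ⊛ Fm) ≗R.≈⟨ ⊛-congˡ (Fm ⊛ Fm) (≗-sym s²≡Q) ⟩
      (s ⊛ s) ⊛ (Fm ⊛ Fm) ≗R.≈⟨ (λ n → fsolve 2 (λ s F → (s :* s) :* (F :* F) := (F :* s) :* (F :* s)) (λ _ → refl) s Fm n) ⟩
      (Fm ⊛ s) ⊛ (Fm ⊛ s) ≗R.≈⟨ ⊛-cong Fm·s≡1 Fm·s≡1 ⟩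
      one ⊛ one ≗R.≈⟨ ⊛-identityˡ one ⟩
      one ≗R.∎)
    (≗-trans (⊛-comm Qr ι) ι·Q≡1)

  D[Fm·s]≡0 : ((D Fm ⊛ s) ⊕ (Fm ⊛ D s)) ≗ zeroS
  D[Fm·s]≡0 = ≗-trans (≗-sym (D-⊛ Fm s)) (≗-trans (D-cong Fm·s≡1) D-one)

  DFm·s : (D Fm ⊛ s) ≗ negS (Fm ⊛ D s)
  DFm·s n = trans (QS.solve 2 (λ a b → a QS.:= (a QS.:+ b) QS.:- b) refl ((D Fm ⊛ s) n) ((Fm ⊛ D s) n)) (trans (cong (_- (Fm ⊛ D s) n) (D[Fm·s]≡0 n)) (QP.+-identityˡ _))

  Ds≡Fm·s·Ds : D s ≗ (Fm ⊛ (s ⊛ D s))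
  Ds≡Fm·s·Ds = ≗-trans (≗-sym (⊛-identityˡ (D s))) (≗-trans (⊛-congˡ (D s) (≗-sym Fm·s≡1)) (⊛-assoc Fm s (D s)))

  D-Fm-expr : D Fm ≗ (Fm ⊛ (cr ⊕ ((cr ⊛ (c2r ⊕ cst1)) ⊛ B)))
  D-Fm-expr = ≗R.begin
    D Fm ≗R.≈⟨ ≗-sym (⊛-identityʳ (D Fm)) ⟩
    D Fm ⊛ one ≗R.≈⟨ ⊛-congʳ (D Fm) (≗-sym (≗-trans (⊛-comm s Fm) Fm·s≡1)) ⟩
    D Fm ⊛ (s ⊛ Fm) ≗R.≈⟨ ≗-sym (⊛-assoc (D Fm) s Fm) ⟩
    (D Fm ⊛ s) ⊛ Fm ≗R.≈⟨ ⊛-congˡ Fm DFm·s ⟩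
    negS (Fm ⊛ D s) ⊛ Fm ≗R.≈⟨ ⊛-congˡ Fm (λ n → cong -_ (⊛-congʳ Fm Ds≡Fm·s·Ds n)) ⟩
    negS (Fm ⊛ (Fm ⊛ (s ⊛ D s))) ⊛ Fm ≗R.≈⟨ (λ n → fsolve 3 (λ F x y → (:- (F :* (F :* y))) :* F := :- ((F :* F) :* (F :* y))) (λ _ → refl) Fm Fm (s ⊛ D s) n) ⟩
    negS ((Fm ⊛ Fm) ⊛ (Fm ⊛ (s ⊛ D s))) ≗R.≈⟨ (λ n → cong -_ (⊛-cong Fm²≡ι (⊛-congʳ Fm s·Ds) n)) ⟩
    negS (ι ⊛ (Fm ⊛ negS (cr ⊛ e))) ≗R.≈⟨ (λ n → fsolve 4 (λ I F cr e → :- (I :* (F :* (:- (cr :* e)))) := F :* (cr :* (I :* e))) (λ _ → refl) ι Fm cr e n) ⟩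
    Fm ⊛ (cr ⊛ (ι ⊛ e)) ≗R.≈⟨ ⊛-congʳ Fm (⊛-congʳ cr (≗-trans ι·e≡ι+B (λ n → cong (_+ B n) (ι≡1+2rB n)))) ⟩
    Fm ⊛ (cr ⊛ ((cst1 ⊕ (c2r ⊛ B)) ⊕ B)) ≗R.≈⟨ (λ n → fsolve 4 (λ F cr c2r B → F :* (cr :* ((con 1ℚ :+ c2r :* B) :+ B)) := F :* (cr :+ (cr :* (c2r :+ con 1ℚ)) :* B)) (λ _ → refl) Fm cr c2r B n) ⟩
    Fm ⊛ (cr ⊕ ((cr ⊛ (c2r ⊕ cst1)) ⊛ B)) ≗R.∎

  c₀ : ℚ
  c₀ = r

  c₁ : ℚ
  c₁ = r * (tr + 1ℚ)

  r₁ : ℚ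
  r₁ = 1ℚ + two * tr

  r₂ : ℚ
  r₂ = tr * tr + tr

  D-Fm : D Fm ≗ (Fm ⊛ (cst c₀ ⊕ (cst c₁ ⊛ B)))
  D-Fm = ≗-trans D-Fm-expr (⊛-congʳ Fm (λ n → cong (cr n +_) (⊛-congˡ B (λ m → trans (⊛-congʳ cr (λ i → sym (cst-+ tr 1ℚ i)) m) (sym (cst-* r (tr + 1ℚ) m))) n)))

  D-B : D B ≗ ((cst1 ⊕ (cst r₁ ⊛ B)) ⊕ (cst r₂ ⊛ (B ⊛ B)))
  D-B = ≗-trans D-B-expr (λ n → cong₂ _+_ (cong (cst1 n +_) (⊛-congˡ B (λ m → trans (cong (cst1 m +_) (sym (cst-* two tr m))) (sym (cst-+ 1ℚ (two * tr) m))) n))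
                                         (⊛-congˡ (B ⊛ B) (λ m → trans (cong₂ _+_ (sym (cst-* tr tr m)) refl) (sym (cst-+ (tr * tr) tr m))) n))

  open ERAProduction Fm B c₀ c₁ r₁ r₂ B0 D-Fm D-B public
    using (prodMatrix; prodMatrix-production; prodMatrix-tridiagonal; prodMatrix-super)

  open MomentsFromProduction (ERA a b) (ERA Fm B) prodMatrix (ERA-lower a b b0) (ERA-lower Fm B B0)
    refl prodMatrix-production prodMatrix-tridiagonal prodMatrix-super TU≡δ UT≡δ public
    using (μ; μ-isMoment; moment-unique)

-- The pipeline: if φ = phiP g has φ'(0) = 1 and ψ = ∫ h is a right inverse of φ
-- for composition, then ψ is also a left inverse, it is the only compositional
-- inverse, and 𝒫(g) = h.  Both facts come from injectivity of u ↦ φ ∘ u.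
pipeline-from-right-inverse : ∀ g h → phiP g 1 ≡ 1ℚ → compose (phiP g) (Integ h) ≗ X → PipelineEq g h
pipeline-from-right-inverse g h φ1 φ∘ψ≡X = (ψ , refl , φ∘ψ≡X , ψ∘φ≡X) , unique
  where
  φ : FPS
  φ = phiP g
  ψ : FPS
  ψ = Integ h
  ψ∘φ≡X : compose ψ φ ≗ X
  ψ∘φ≡X = compose-inj φ (compose ψ φ) X φ1 refl refl (≗R.begin
    compose φ (compose ψ φ) ≗R.≈⟨ ≗-sym (compose-assoc φ ψ φ refl refl) ⟩
    compose (compose φ ψ) φ ≗R.≈⟨ compose-cong φ∘ψ≡X (λ _ → refl) ⟩
    compose X φ             ≗R.≈⟨ compose-X φ refl ⟩
    φ                       ≗R.≈⟨ ≗-sym (compose-gX φ) ⟩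
    compose φ X             ≗R.∎)
  unique : ∀ ψ′ → IsCompInverse φ ψ′ → D ψ′ ≗ h
  unique ψ′ (ψ′0 , φ∘ψ′≡X , _) =
    ≗-trans (D-cong (compose-inj φ ψ′ ψ φ1 ψ′0 refl (≗-trans φ∘ψ′≡X (≗-sym φ∘ψ≡X)))) (D-Integ h)

-- The denominator
-- gives a three-term recurrence for the coefficients of g, i.e. a linear ODE
-- for the e.g.f.s  g̃_k = Σ_n g_(k+n) zⁿ/n!  (k = 0, 1, 2).  With ψ = ∫ Fm, the
-- compositions Gψ k = g̃_k ∘ ψ solve the same ODE system (in the variable z,
-- with ψ' = Fm) as the explicit series
--   E = e^(ψ - z),   w E,   (r e^z + w²) E,    w = 1 - s,  s = √Q,
-- and they agree at z = 0, so Gψ k equals them.  Hence φ'∘ψ = 1 - g̃'/g̃ ∘ ψ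
-- = 1 - w = s, so (φ∘ψ)' = s·Fm = 1 and φ∘ψ = z.
module Pipeline11 (r : ℚ) where
  open Theorem11 r

  g : FPS
  g = gP r

  num : FPS
  num = poly2 (- fromℕ 3) (- (r - two))

  den : FPS
  den = poly1 (- 1ℚ) ⊛ poly2 (- two) (- (two * r))

  ca : ℚ
  ca = - 1ℚ

  cb : ℚ
  cb = - two

  cc : ℚ
  cc = - (two * r)

  den·g≡num : (den ⊛ g) ≗ num
  den·g≡num = ≗R.begin
    den ⊛ (num ⊛ recip1 den) ≗R.≈⟨ (λ n → fsolve 3 (λ d m q → d :* (m :* q) := m :* (q :* d)) (λ _ → refl) den num (recip1 den) n) ⟩
    num ⊛ (recip1 den ⊛ den) ≗R.≈⟨ ⊛-congʳ num (recip1-invˡ den refl) ⟩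
    num ⊛ one ≗R.≈⟨ ⊛-identityʳ num ⟩
    num ≗R.∎

  -- den = 1 + α z + β z² + γ z³.
  α : ℚ
  α = ca + cb

  β : ℚ
  β = ca * cb + cc

  γ : ℚ
  γ = ca * cc

  den·g-expanded : (den ⊛ g) ≗ (((g ⊕ (cst α ⊛ (X ⊛ g))) ⊕ (cst β ⊛ (X ⊛ (X ⊛ g)))) ⊕ (cst γ ⊛ (X ⊛ (X ⊛ (X ⊛ g)))))
  den·g-expanded = ≗R.begin
    den ⊛ g ≗R.≈⟨ ⊛-congˡ g (⊛-cong (poly1-eq ca) (poly2-eq cb cc)) ⟩
    ((cst1 ⊕ (cst ca ⊛ X)) ⊛ ((cst1 ⊕ (cst cb ⊛ X)) ⊕ (cst cc ⊛ (X ⊛ X)))) ⊛ g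
      ≗R.≈⟨ (λ n → fsolve 5 (λ A B C X g → ((con 1ℚ :+ A :* X) :* ((con 1ℚ :+ B :* X) :+ C :* (X :* X))) :* g := ((g :+ (A :+ B) :* (X :* g)) :+ (A :* B :+ C) :* (X :* (X :* g))) :+ (A :* C) :* (X :* (X :* (X :* g)))) (λ _ → refl) (cst ca) (cst cb) (cst cc) X g n) ⟩
    ((g ⊕ ((cst ca ⊕ cst cb) ⊛ (X ⊛ g))) ⊕ (((cst ca ⊛ cst cb) ⊕ cst cc) ⊛ (X ⊛ (X ⊛ g)))) ⊕ ((cst ca ⊛ cst cc) ⊛ (X ⊛ (X ⊛ (X ⊛ g))))
      ≗R.≈⟨ (λ n → cong₂ _+_ (cong₂ _+_ (cong (g n +_) (⊛-congˡ (X ⊛ g) (≗-sym (cst-+ ca cb)) n))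
                                         (⊛-congˡ (X ⊛ (X ⊛ g)) (≗-trans (λ m → cong (_+ cst cc m) (sym (cst-* ca cb m))) (≗-sym (cst-+ (ca * cb) cc))) n))
                              (⊛-congˡ (X ⊛ (X ⊛ (X ⊛ g))) (≗-sym (cst-* ca cc)) n)) ⟩
    ((g ⊕ (cst α ⊛ (X ⊛ g))) ⊕ (cst β ⊛ (X ⊛ (X ⊛ g)))) ⊕ (cst γ ⊛ (X ⊛ (X ⊛ (X ⊛ g)))) ≗R.∎

  den·g-coeff : ∀ n → (den ⊛ g) n ≡ ((g n + α * (X ⊛ g) n) + β * (X ⊛ (X ⊛ g)) n) + γ * (X ⊛ (X ⊛ (X ⊛ g))) n
  den·g-coeff n = trans (den·g-expanded n) (cong₂ _+_ (cong₂ _+_ (cong (g n +_) (sym (scale-cst α (X ⊛ g) n))) (sym (scale-cst β (X ⊛ (X ⊛ g)) n))) (sym (scale-cst γ (X ⊛ (X ⊛ (X ⊛ g))) n)))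

  g-recurrence : ∀ n → ((g (3 N.+ n) + α * g (2 N.+ n)) + β * g (1 N.+ n)) + γ * g n ≡ 0ℚ
  g-recurrence n = trans (sym (trans (den·g-coeff (3 N.+ n)) (cong₂ _+_ (cong₂ _+_ (cong (λ z → g (3 N.+ n) + α * z) (X⊛-suc g (2 N.+ n)))
                     (cong (β *_) (trans (X⊛-suc (X ⊛ g) (2 N.+ n)) (X⊛-suc g (1 N.+ n)))))
                     (cong (γ *_) (trans (X⊛-suc (X ⊛ (X ⊛ g)) (2 N.+ n)) (trans (X⊛-suc (X ⊛ g) (1 N.+ n)) (X⊛-suc g n)))))))
                 (den·g≡num (3 N.+ n))

  g0 : g 0 ≡ 1ℚ
  g0 = refl

  g1 : g 1 ≡ 0ℚ
  g1 = refl

  g2 : g 2 ≡ r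
  g2 = begin
    g 2 ≡⟨ QS.solve 4 (λ x a b c → x QS.:= (((x QS.:+ a QS.:* QS.con 0ℚ) QS.:+ b QS.:* QS.con 1ℚ) QS.:+ c QS.:* QS.con 0ℚ) QS.:- b) refl (g 2) α β γ ⟩
    (((g 2 + α * 0ℚ) + β * 1ℚ) + γ * 0ℚ) - β
      ≡⟨ cong (_- β) (sym (trans (den·g-coeff 2) (cong₂ _+_ (cong₂ _+_ (cong (λ z → g 2 + α * z) (trans (X⊛-suc g 1) g1))
                              (cong (β *_) (trans (X⊛-suc (X ⊛ g) 1) (X⊛-suc g 0))))
                              (cong (γ *_) (trans (X⊛-suc (X ⊛ (X ⊛ g)) 1) (X⊛-zero (X ⊛ g))))))) ⟩
    (den ⊛ g) 2 - β ≡⟨ cong (_- β) (den·g≡num 2) ⟩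
    - (r - two) - β ≡⟨ QS.solve 1 (λ r → QS.:- (r QS.:- QS.con two) QS.:- ((QS.:- QS.con 1ℚ) QS.:* (QS.:- QS.con two) QS.:+ (QS.:- (QS.con two QS.:* r))) QS.:= r) refl r ⟩
    r ∎

  gShift : ℕ → FPS
  gShift = shiftEGF g

  a2 : ℚ
  a2 = - α

  a1 : ℚ
  a1 = - β

  a0 : ℚ
  a0 = - γ

  gShift-ode : gShift 3 ≗ (((cst a2 ⊛ gShift 2) ⊕ (cst a1 ⊛ gShift 1)) ⊕ (cst a0 ⊛ gShift 0))
  gShift-ode n = trans h (cong₂ _+_ (cong₂ _+_ (scale-cst a2 (gShift 2) n) (scale-cst a1 (gShift 1) n)) (scale-cst a0 (gShift 0) n))
    where
    x3 : ℚ
    x3 = g (3 N.+ n)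
    x2 : ℚ
    x2 = g (2 N.+ n)
    x1 : ℚ
    x1 = g (1 N.+ n)
    x0 : ℚ
    x0 = g n
    i : ℚ
    i = invFact n
    RHS : ℚ
    RHS = (a2 * (x2 * i) + a1 * (x1 * i)) + a0 * (x0 * i)
    h : gShift 3 n ≡ RHS
    h = trans (QS.solve 8 (λ x3 x2 x1 x0 a b c i → x3 QS.:* i QS.:= (((QS.:- a) QS.:* (x2 QS.:* i) QS.:+ (QS.:- b) QS.:* (x1 QS.:* i)) QS.:+ (QS.:- c) QS.:* (x0 QS.:* i)) QS.:+ (((x3 QS.:+ a QS.:* x2) QS.:+ b QS.:* x1) QS.:+ c QS.:* x0) QS.:* i) refl x3 x2 x1 x0 α β γ i)
          (trans (cong (λ z → RHS + z * i) (g-recurrence n)) (trans (cong (RHS +_) (QP.*-zeroˡ i)) (QP.+-identityʳ RHS)))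

  ψ : FPS
  ψ = Integ Fm

  Dψ : D ψ ≗ Fm
  Dψ = D-Integ Fm

  Gψ : ℕ → FPS
  Gψ i = compose (gShift i) ψ

  D-Gψ : ∀ i → D (Gψ i) ≗ (Gψ (suc i) ⊛ Fm)
  D-Gψ i = ≗-trans (chain-rule (gShift i) ψ refl) (⊛-cong (compose-cong (D-shiftEGF g i) (λ _ → refl)) Dψ)

  Gψ-ode : Gψ 3 ≗ (((cst a2 ⊛ Gψ 2) ⊕ (cst a1 ⊛ Gψ 1)) ⊕ (cst a0 ⊛ Gψ 0))
  Gψ-ode = ≗R.begin
    compose (gShift 3) ψ ≗R.≈⟨ compose-cong gShift-ode (λ _ → refl) ⟩
    compose (((cst a2 ⊛ gShift 2) ⊕ (cst a1 ⊛ gShift 1)) ⊕ (cst a0 ⊛ gShift 0)) ψ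
      ≗R.≈⟨ ≗-trans (compose-⊕ ((cst a2 ⊛ gShift 2) ⊕ (cst a1 ⊛ gShift 1)) (cst a0 ⊛ gShift 0) ψ) (λ n → cong₂ _+_ (compose-⊕ (cst a2 ⊛ gShift 2) (cst a1 ⊛ gShift 1) ψ n) refl) ⟩
    (compose (cst a2 ⊛ gShift 2) ψ ⊕ compose (cst a1 ⊛ gShift 1) ψ) ⊕ compose (cst a0 ⊛ gShift 0) ψ
      ≗R.≈⟨ (λ n → cong₂ _+_ (cong₂ _+_ (cm a2 2 n) (cm a1 1 n)) (cm a0 0 n)) ⟩
    ((cst a2 ⊛ Gψ 2) ⊕ (cst a1 ⊛ Gψ 1)) ⊕ (cst a0 ⊛ Gψ 0) ≗R.∎
    where
    cm : ∀ c i → compose (cst c ⊛ gShift i) ψ ≗ (cst c ⊛ Gψ i)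
    cm c i = ≗-trans (compose-mult (cst c) (gShift i) ψ refl) (⊛-congˡ (Gψ i) (compose-cst c ψ))

  E : FPS
  E = compose expS (ψ ⊖ X)

  w : FPS
  w = cst1 ⊖ s

  Fm-1≡Fm·w : (Fm ⊖ one) ≗ (Fm ⊛ w)
  Fm-1≡Fm·w = ≗R.begin
    Fm ⊖ one ≗R.≈⟨ (λ n → cong₂ _-_ (sym (⊛-identityʳ Fm n)) (sym (Fm·s≡1 n))) ⟩
    (Fm ⊛ one) ⊖ (Fm ⊛ s) ≗R.≈⟨ (λ n → cong (λ z → z - (Fm ⊛ s) n) (⊛-congʳ Fm one≡cst1 n)) ⟩
    (Fm ⊛ cst1) ⊖ (Fm ⊛ s) ≗R.≈⟨ (λ n → fsolve 2 (λ F s → F :* con 1ℚ :- F :* s := F :* (con 1ℚ :- s)) (λ _ → refl) Fm s n) ⟩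
    Fm ⊛ w ≗R.∎

  D-E : D E ≗ (E ⊛ (Fm ⊛ w))
  D-E = ≗-trans (D-exp (ψ ⊖ X) refl) (⊛-congʳ E (≗-trans (D-⊖ ψ X) (≗-trans (λ n → cong₂ _-_ (Dψ n) (D-X n)) Fm-1≡Fm·w)))

  D-w : D w ≗ (Fm ⊛ (cr ⊛ e))
  D-w = ≗R.begin
    D w ≗R.≈⟨ D-⊖ cst1 s ⟩
    D cst1 ⊖ D s ≗R.≈⟨ (λ n → cong₂ _-_ (D-cst 1ℚ n) (≗-trans Ds≡Fm·s·Ds (⊛-congʳ Fm s·Ds) n)) ⟩
    zeroS ⊖ (Fm ⊛ negS (cr ⊛ e)) ≗R.≈⟨ (λ n → trans (QP.+-identityˡ (- (Fm ⊛ negS (cr ⊛ e)) n)) (fsolve 3 (λ F cr e → :- (F :* (:- (cr :* e))) := F :* (cr :* e)) (λ _ → refl) Fm cr e n)) ⟩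
    Fm ⊛ (cr ⊛ e) ≗R.∎

  Kψ : ℕ → FPS
  Kψ 0 = E
  Kψ 1 = w ⊛ E
  Kψ 2 = ((cr ⊛ e) ⊕ (w ⊛ w)) ⊛ E
  Kψ _ = zeroS

  D-Kψ0 : D (Kψ 0) ≗ (Kψ 1 ⊛ Fm)
  D-Kψ0 = ≗-trans D-E (λ n → fsolve 3 (λ E F w → E :* (F :* w) := (w :* E) :* F) (λ _ → refl) E Fm w n)

  D-Kψ1 : D (Kψ 1) ≗ (Kψ 2 ⊛ Fm)
  D-Kψ1 = ≗R.begin
    D (w ⊛ E) ≗R.≈⟨ D-⊛ w E ⟩
    (D w ⊛ E) ⊕ (w ⊛ D E) ≗R.≈⟨ (λ n → cong₂ _+_ (⊛-congˡ E D-w n) (⊛-congʳ w D-E n)) ⟩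
    ((Fm ⊛ (cr ⊛ e)) ⊛ E) ⊕ (w ⊛ (E ⊛ (Fm ⊛ w))) ≗R.≈⟨ (λ n → fsolve 5 (λ F cr e E w → (F :* (cr :* e)) :* E :+ w :* (E :* (F :* w)) := ((cr :* e) :+ w :* w) :* E :* F) (λ _ → refl) Fm cr e E w n) ⟩
    Kψ 2 ⊛ Fm ≗R.∎

  a2-eq : a2 ≡ ℤ+ 3 / 1
  a2-eq = refl

  a1-eq : a1 ≡ - two + two * r
  a1-eq = QS.solve 1 (λ r → QS.:- ((QS.:- QS.con 1ℚ) QS.:* (QS.:- QS.con two) QS.:+ (QS.:- (QS.con two QS.:* r))) QS.:= QS.:- QS.con two QS.:+ QS.con two QS.:* r) refl r

  a0-eq : a0 ≡ - two * r
  a0-eq = QS.solve 1 (λ r → QS.:- ((QS.:- QS.con 1ℚ) QS.:* (QS.:- (QS.con two QS.:* r))) QS.:= QS.:- QS.con two QS.:* r) refl r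

  Fm·r·e : FPS
  Fm·r·e = Fm ⊛ (cr ⊛ e)

  Y : FPS
  Y = ((cst1 ⊕ (cst two ⊛ cr)) ⊖ ((cst (fromℕ 3) ⊛ cr) ⊛ e)) ⊖ (s ⊛ s)

  Qx : FPS
  Qx = cst1 ⊕ ((cst two ⊛ cr) ⊛ (cst1 ⊖ e))

  Qx-ss : (s ⊛ s) ≗ Qx
  Qx-ss = ≗-trans s²≡Q (≗-trans Q-eq (λ n → cong (cst1 n +_) (⊛-congˡ (cst1 ⊖ e) c2r≡2·r n)))

  RHS2 : FPS
  RHS2 = (((cst (fromℕ 3) ⊛ Kψ 2) ⊕ ((cst (- two) ⊕ (cst two ⊛ cr)) ⊛ Kψ 1)) ⊕ ((cst (- two) ⊛ cr) ⊛ Kψ 0)) ⊛ Fm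

  -- The middle step is a
  -- polynomial identity that holds up to the relations Fm·s = 1 and s² = Q,
  -- which are then used to cancel the extra terms.
  D-Kψ2 : D (Kψ 2) ≗ ((((cst a2 ⊛ Kψ 2) ⊕ (cst a1 ⊛ Kψ 1)) ⊕ (cst a0 ⊛ Kψ 0)) ⊛ Fm)
  D-Kψ2 = ≗R.begin
    D (((cr ⊛ e) ⊕ (w ⊛ w)) ⊛ E) ≗R.≈⟨ D-⊛ ((cr ⊛ e) ⊕ (w ⊛ w)) E ⟩
    (D ((cr ⊛ e) ⊕ (w ⊛ w)) ⊛ E) ⊕ (((cr ⊛ e) ⊕ (w ⊛ w)) ⊛ D E)
      ≗R.≈⟨ (λ n → cong₂ _+_ (⊛-congˡ E (≗-trans (D-⊕ (cr ⊛ e) (w ⊛ w)) (λ m → cong₂ _+_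
               (trans (D-⊛ cr e m) (cong₂ _+_ (⊛-congˡ e (≗-trans (D-cst r) zeroS≡cst0) m) (⊛-congʳ cr D-expS m)))
               (trans (D-⊛ w w m) (cong₂ _+_ (⊛-congˡ w D-w m) (⊛-congʳ w D-w m))))) n)
             (⊛-congʳ ((cr ⊛ e) ⊕ (w ⊛ w)) D-E n)) ⟩
    ((((cst 0ℚ ⊛ e) ⊕ (cr ⊛ e)) ⊕ ((Fm·r·e ⊛ w) ⊕ (w ⊛ Fm·r·e))) ⊛ E) ⊕ (((cr ⊛ e) ⊕ (w ⊛ w)) ⊛ (E ⊛ (Fm ⊛ w)))
      ≗R.≈⟨ (λ n → fsolve 5 (λ F s e cr E →
             ((((con 0ℚ :* e) :+ (cr :* e)) :+ ((F :* (cr :* e)) :* (con 1ℚ :- s) :+ (con 1ℚ :- s) :* (F :* (cr :* e)))) :* E) :+ (((cr :* e) :+ (con 1ℚ :- s) :* (con 1ℚ :- s)) :* (E :* (F :* (con 1ℚ :- s))))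
             := ((((con (fromℕ 3) :* (((cr :* e) :+ (con 1ℚ :- s) :* (con 1ℚ :- s)) :* E)) :+ ((con (- two) :+ con two :* cr) :* ((con 1ℚ :- s) :* E))) :+ ((con (- two) :* cr) :* E)) :* F)
                :+ E :* (((F :* s) :- con 1ℚ) :* (((con 1ℚ :+ con two :* cr) :- (con (fromℕ 3) :* cr) :* e) :- s :* s) :+ ((con 1ℚ :+ (con two :* cr) :* (con 1ℚ :- e)) :- s :* s)))
             (λ _ → refl) Fm s e cr E n) ⟩
    RHS2 ⊕ (E ⊛ ((((Fm ⊛ s) ⊖ cst1) ⊛ Y) ⊕ (Qx ⊖ (s ⊛ s))))
      ≗R.≈⟨ (λ n → cong (RHS2 n +_) (⊛-congʳ E (λ m → cong₂ _+_ (⊛-congˡ Y (λ i → cong (_- cst1 i) (trans (Fm·s≡1 i) (one≡cst1 i))) m) (cong (λ z → Qx m - z) (Qx-ss m))) n)) ⟩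
    RHS2 ⊕ (E ⊛ (((cst1 ⊖ cst1) ⊛ Y) ⊕ (Qx ⊖ Qx)))
      ≗R.≈⟨ (λ n → fsolve 4 (λ A E Y Q → A :+ E :* ((con 1ℚ :- con 1ℚ) :* Y :+ (Q :- Q)) := A) (λ _ → refl) RHS2 E Y Qx n) ⟩
    RHS2
      ≗R.≈⟨ ⊛-congˡ Fm (λ n → cong₂ _+_ (cong₂ _+_ (⊛-congˡ (Kψ 2) (cst-cong (sym a2-eq)) n)
              (⊛-congˡ (Kψ 1) (≗-trans (λ m → cong (cst (- two) m +_) (sym (cst-* two r m))) (≗-trans (≗-sym (cst-+ (- two) (two * r))) (cst-cong (sym a1-eq)))) n))
              (⊛-congˡ (Kψ 0) (≗-trans (≗-sym (cst-* (- two) r)) (cst-cong (sym a0-eq))) n)) ⟩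
    (((cst a2 ⊛ Kψ 2) ⊕ (cst a1 ⊛ Kψ 1)) ⊕ (cst a0 ⊛ Kψ 0)) ⊛ Fm ≗R.∎

  -- The differences Δ k = Gψ k - Kψ k solve a homogeneous linear system with zero
  -- initial values, hence vanish.
  Δ : ℕ → FPS
  Δ 0 = Gψ 0 ⊖ Kψ 0
  Δ 1 = Gψ 1 ⊖ Kψ 1
  Δ 2 = Gψ 2 ⊖ Kψ 2
  Δ _ = zeroS

  lincomb : FPS → FPS → FPS → FPS
  lincomb x y z = ((cst a2 ⊛ z) ⊕ (cst a1 ⊛ y)) ⊕ (cst a0 ⊛ x)

  Gψ2-const : Gψ 2 0 ≡ r
  Gψ2-const = trans (cong (λ z → 0ℚ + z * invFact 0 * 1ℚ) g2) (QS.solve 1 (λ r → QS.con 0ℚ QS.:+ r QS.:* QS.con 1ℚ QS.:* QS.con 1ℚ QS.:= r) refl r)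

  Kψ2-const : Kψ 2 0 ≡ r
  Kψ2-const = QS.solve 1 (λ r → QS.con 0ℚ QS.:+ ((QS.con 0ℚ QS.:+ r QS.:* QS.con 1ℚ) QS.:+ (QS.con 0ℚ QS.:+ (QS.con 1ℚ QS.:- QS.con 1ℚ) QS.:* (QS.con 1ℚ QS.:- QS.con 1ℚ))) QS.:* QS.con 1ℚ QS.:= r) refl r

  Δ-const : ∀ i → Δ i 0 ≡ 0ℚ
  Δ-const 0 = refl
  Δ-const 1 = refl
  Δ-const 2 = trans (cong₂ _-_ Gψ2-const Kψ2-const) (QP.+-inverseʳ r)
  Δ-const (suc (suc (suc i))) = refl

  ·Fm-vanish : ∀ h n → (∀ m → m N.≤ n → h m ≡ 0ℚ) → (h ⊛ Fm) n ≡ 0ℚ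
  ·Fm-vanish h n z = trans (⊛-comm h Fm n) (⊛-vanish Fm h n z)

  lincomb-vanish : ∀ x y z n → (∀ m → m N.≤ n → x m ≡ 0ℚ) → (∀ m → m N.≤ n → y m ≡ 0ℚ) → (∀ m → m N.≤ n → z m ≡ 0ℚ) → ∀ m → m N.≤ n → lincomb x y z m ≡ 0ℚ
  lincomb-vanish x y z n zx zy zz m le = trans (cong₂ _+_ (cong₂ _+_ (sym (scale-cst a2 z m)) (sym (scale-cst a1 y m))) (sym (scale-cst a0 x m)))
    (trans (cong₂ _+_ (cong₂ _+_ (cong (a2 *_) (zz m le)) (cong (a1 *_) (zy m le))) (cong (a0 *_) (zx m le)))
      (QS.solve 3 (λ a b c → (a QS.:* QS.con 0ℚ QS.:+ b QS.:* QS.con 0ℚ) QS.:+ c QS.:* QS.con 0ℚ QS.:= QS.con 0ℚ) refl a2 a1 a0))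

  Δ-step : ∀ i n → (∀ j m → m N.≤ n → Δ j m ≡ 0ℚ) → D (Δ i) n ≡ 0ℚ
  Δ-step 0 n z = trans (D-⊖ (Gψ 0) (Kψ 0) n) (trans (cong₂ _-_ (D-Gψ 0 n) (D-Kψ0 n))
    (trans (fsolve 3 (λ g k F → g :* F :- k :* F := (g :- k) :* F) (λ _ → refl) (Gψ 1) (Kψ 1) Fm n) (·Fm-vanish (Δ 1) n (z 1))))
  Δ-step 1 n z = trans (D-⊖ (Gψ 1) (Kψ 1) n) (trans (cong₂ _-_ (D-Gψ 1 n) (D-Kψ1 n))
    (trans (fsolve 3 (λ g k F → g :* F :- k :* F := (g :- k) :* F) (λ _ → refl) (Gψ 2) (Kψ 2) Fm n) (·Fm-vanish (Δ 2) n (z 2))))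
  Δ-step 2 n z = trans (D-⊖ (Gψ 2) (Kψ 2) n) (trans (cong₂ _-_ (trans (D-Gψ 2 n) (⊛-congˡ Fm Gψ-ode n)) (D-Kψ2 n))
    (trans (fsolve 10 (λ A2 A1 A0 g0 g1 g2 k0 k1 k2 F → ((A2 :* g2 :+ A1 :* g1) :+ A0 :* g0) :* F :- ((A2 :* k2 :+ A1 :* k1) :+ A0 :* k0) :* F
                        := ((A2 :* (g2 :- k2) :+ A1 :* (g1 :- k1)) :+ A0 :* (g0 :- k0)) :* F) (λ _ → refl) (cst a2) (cst a1) (cst a0) (Gψ 0) (Gψ 1) (Gψ 2) (Kψ 0) (Kψ 1) (Kψ 2) Fm n)
      (·Fm-vanish (lincomb (Δ 0) (Δ 1) (Δ 2)) n (lincomb-vanish (Δ 0) (Δ 1) (Δ 2) n (z 0) (z 1) (z 2)))))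
  Δ-step (suc (suc (suc i))) n z = QP.*-zeroʳ (fromℕ (suc n))

  Δ≡0 : ∀ i n → Δ i n ≡ 0ℚ
  Δ≡0 = ode-system-unique Δ Δ-const Δ-step

  Gψ0≡E : Gψ 0 ≗ E
  Gψ0≡E = ⊖-zero (Gψ 0) (Kψ 0) (Δ≡0 0)

  Gψ1≡wE : Gψ 1 ≗ (w ⊛ E)
  Gψ1≡wE = ⊖-zero (Gψ 1) (Kψ 1) (Δ≡0 1)

  g̃ : FPS
  g̃ = tildeS g

  φ : FPS
  φ = phiP g

  [1/g̃]∘ψ : FPS
  [1/g̃]∘ψ = compose (recip1 g̃) ψ

  E·[1/g̃]∘ψ≡1 : (E ⊛ [1/g̃]∘ψ) ≗ one
  E·[1/g̃]∘ψ≡1 = ≗-trans (⊛-comm E [1/g̃]∘ψ) (≗-trans (⊛-congʳ [1/g̃]∘ψ (≗-sym Gψ0≡E)) (compose-inv (recip1 g̃) g̃ ψ refl (recip1-invˡ g̃ refl)))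

  Dφ∘ψ≡s : compose (D φ) ψ ≗ s
  Dφ∘ψ≡s = ≗R.begin
    compose (D φ) ψ ≗R.≈⟨ compose-cong (D-Integ (one ⊖ (D g̃ ⊛ recip1 g̃))) (λ _ → refl) ⟩
    compose (one ⊖ (D g̃ ⊛ recip1 g̃)) ψ ≗R.≈⟨ compose-⊖ one (D g̃ ⊛ recip1 g̃) ψ ⟩
    compose one ψ ⊖ compose (D g̃ ⊛ recip1 g̃) ψ ≗R.≈⟨ (λ n → cong₂ _-_ (trans (compose-one ψ n) (one≡cst1 n)) (compose-mult (D g̃) (recip1 g̃) ψ refl n)) ⟩
    cst1 ⊖ (compose (D g̃) ψ ⊛ [1/g̃]∘ψ) ≗R.≈⟨ (λ n → cong (λ z → cst1 n - z) (⊛-congˡ [1/g̃]∘ψ (≗-trans (compose-cong (D-shiftEGF g 0) (λ _ → refl)) Gψ1≡wE) n)) ⟩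
    cst1 ⊖ ((w ⊛ E) ⊛ [1/g̃]∘ψ) ≗R.≈⟨ (λ n → cong (λ z → cst1 n - z) (trans (⊛-assoc w E [1/g̃]∘ψ n) (trans (⊛-congʳ w E·[1/g̃]∘ψ≡1 n) (⊛-identityʳ w n)))) ⟩
    cst1 ⊖ w ≗R.≈⟨ (λ n → fsolve 1 (λ s → con 1ℚ :- (con 1ℚ :- s) := s) (λ _ → refl) s n) ⟩
    s ≗R.∎

  -- (φ ∘ ψ)' = (φ' ∘ ψ) ψ' = s · Fm = 1, so φ ∘ ψ = z.
  φ∘ψ≡X : compose φ ψ ≗ X
  φ∘ψ≡X = D-inj (≗-trans (chain-rule φ ψ refl) (≗-trans (⊛-cong Dφ∘ψ≡s Dψ) (≗-trans (≗-trans (⊛-comm s Fm) Fm·s≡1) (≗-sym D-X)))) refl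

  pipeline : PipelineEq g Fm
  pipeline = pipeline-from-right-inverse g Fm refl φ∘ψ≡X

mainTheorem11 : (r : ℚ) → r ≢ 0ℚ →
    let T = ERA (aT r) (bT r)
        U = ERA (Fmom r) (bU r)
    in Σ (ℕ → ℚ) (IsMomentSeq T)
       × (∀ ν → IsMomentSeq T ν → ∀ n → (ν n * invFact n ≡ Fmom r n) × (ν n ≡ U n 0))
       × Σ Mat (λ P → IsProductionMatrix U P × Tridiagonal P)
       × (gP r 0 ≡ 1ℚ) × (gP r 1 ≢ 1ℚ) × PipelineEq (gP r) (Fmom r)
       × (∀ n k → lmul T U n k ≡ δ n k) × (∀ n k → lmul U T n k ≡ δ n k)
mainTheorem11 r _ =
  (μ , μ-isMoment) ,
  (λ ν ν-isMoment n → let ν≡μ = moment-unique ν ν-isMoment n in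
     trans (cong (_* invFact n) ν≡μ) (ERA-column Fm B n) , ν≡μ) ,
  (prodMatrix , prodMatrix-production , prodMatrix-tridiagonal) ,
  g0 ,
  (λ g1≡1 → QP.1≢0 (trans (sym g1≡1) g1)) ,
  pipeline ,
  TU≡δ ,
  UT≡δ
  where
  open Theorem11 r
  open Pipeline11 r using (g0; g1; pipeline)
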